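{- The set $J_{1/2}$ is I-stable and $\overline{\delta}(J_{1/2}) = 1/2$.
   Context: A lattice triangle is the convex hull in $\mathbb{R}^2$ of three non-collinear points of $\mathbb{Z}^2$. A triangle is a set $T = \Delta \cap \mathbb{Z}^2$ for a lattice triangle $\Delta$. An internal triangle is a triangle containing exactly $4$ points of $\mathbb{Z}^2$ whose non-vertex point lies in the interior of $\Delta$. A set $S \subseteq \mathbb{Z}^2$ is I-stable if no internal triangle has exactly three of its points in $S$. Let $\Delta_0 = \{(0,0),(1,0),(0,1),(-1,-1)\}$, $J_{1/4} = \Delta_0 + 4\mathbb{Z}^2$ and $J_{1/2} = J_{1/4} \cup (J_{1/4} + (2,2))$. For integers $a\le b$, $[a,b]=\{i\in\mathbb{Z}: a\le i\le b\}$. The upper density of $X\subseteq\mathbb{Z}^2$ is $\overline{\delta}(X)=\limsup_{n\to\infty}|X\cap[-n,n]^2|/|[-n,n]^2|$. -}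

module Defs where

open import Data.Nat as ℕ using (ℕ; suc; _≥_)
open import Data.Integer as ℤ using (ℤ; +_; -_) renaming (_-_ to _-ℤ_; _+_ to _+ℤ_; _*_ to _*ℤ_; _≤_ to _≤ℤ_)
open import Data.Rational as ℚ using (ℚ; 0ℚ; 1ℚ; _/_; _<_; _≤_; _+_; _*_; _-_)
open import Data.Product using (Σ; ∃; ∃-syntax; _×_; _,_; proj₁; proj₂)
open import Data.Sum using (_⊎_)
open import Data.List using (List; length)
open import Data.List.Membership.Propositional using (_∈_)
open import Data.List.Relation.Unary.Unique.Propositional using (Unique)
open import Relation.Binary.PropositionalEquality using (_≡_; _≢_)
open import Relation.Nullary using (¬_)
open import Function.Bundles using (_⇔_)
open import Level using (0ℓ)
open import Relation.Unary using (Pred)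

Point : Set
Point = ℤ × ℤ

toℚ : ℤ → ℚ
toℚ z = z / 1

-- p is a convex combination λa + μb + νc (λ,μ,ν ≥ 0, λ+μ+ν = 1), i.e. p ∈ conv{a,b,c}.
-- Rational coefficients suffice since p, a, b, c are lattice points.
InHull : Point → Point → Point → Point → Set
InHull (ax , ay) (bx , by) (cx , cy) (px , py) =
  ∃[ l ] ∃[ m ] ∃[ n ]
    (0ℚ ≤ l) × (0ℚ ≤ m) × (0ℚ ≤ n) × (l + m + n ≡ 1ℚ)
    × (l * toℚ ax + m * toℚ bx + n * toℚ cx ≡ toℚ px)
    × (l * toℚ ay + m * toℚ by + n * toℚ cy ≡ toℚ py)

InInterior : Point → Point → Point → Point → Set
InInterior (ax , ay) (bx , by) (cx , cy) (px , py) =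
  ∃[ l ] ∃[ m ] ∃[ n ]
    (0ℚ < l) × (0ℚ < m) × (0ℚ < n) × (l + m + n ≡ 1ℚ)
    × (l * toℚ ax + m * toℚ bx + n * toℚ cx ≡ toℚ px)
    × (l * toℚ ay + m * toℚ by + n * toℚ cy ≡ toℚ py)

NonCollinear : Point → Point → Point → Set
NonCollinear (ax , ay) (bx , by) (cx , cy) =
  (bx -ℤ ax) *ℤ (cy -ℤ ay) -ℤ (by -ℤ ay) *ℤ (cx -ℤ ax) ≢ + 0

InternalTriangle : Point → Point → Point → Point → Set
InternalTriangle a b c p =
  NonCollinear a b c
  × InInterior a b c p
  × (∀ q → InHull a b c q → (q ≡ a) ⊎ (q ≡ b) ⊎ (q ≡ c) ⊎ (q ≡ p))

ExactlyThreeIn : Pred Point 0ℓ → Point → Point → Point → Point → Set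
ExactlyThreeIn S a b c p =
    (¬ S a × S b × S c × S p)
  ⊎ (S a × ¬ S b × S c × S p)
  ⊎ (S a × S b × ¬ S c × S p)
  ⊎ (S a × S b × S c × ¬ S p)

IStable : Pred Point 0ℓ → Set
IStable S = ∀ a b c p → InternalTriangle a b c p → ¬ ExactlyThreeIn S a b c p

Δ₀ : Pred Point 0ℓ
Δ₀ d = (d ≡ (+ 0 , + 0)) ⊎ (d ≡ (+ 1 , + 0)) ⊎ (d ≡ (+ 0 , + 1)) ⊎ (d ≡ (- + 1 , - + 1))

J¼ : Pred Point 0ℓ
J¼ (x , y) = ∃[ d ] ∃[ u ] ∃[ v ] Δ₀ d × (x ≡ proj₁ d +ℤ + 4 *ℤ u) × (y ≡ proj₂ d +ℤ + 4 *ℤ v)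

J½ : Pred Point 0ℓ
J½ p = J¼ p ⊎ (∃[ q ] J¼ q × (p ≡ (proj₁ q +ℤ + 2 , proj₂ q +ℤ + 2)))

InBox : ℕ → Point → Set
InBox n (x , y) = (- + n ≤ℤ x) × (x ≤ℤ + n) × (- + n ≤ℤ y) × (y ≤ℤ + n)

BoxCount : Pred Point 0ℓ → ℕ → ℕ → Set
BoxCount X n k = ∃[ L ] Unique L × (∀ p → (p ∈ L) ⇔ (InBox n p × X p)) × (length L ≡ k)

ratio : ℕ → ℕ → ℚ
ratio k n = (+ k) / (suc (2 ℕ.* n) ℕ.* suc (2 ℕ.* n))

-- upper density of X equals r:  limsup_n |X ∩ [-n,n]²| / (2n+1)² = r, i.e.
-- (i) for every ε > 0, eventually the ratio is < r + ε, and
-- (ii) for every ε > 0, the ratio is > r - ε for infinitely many n.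
UpperDensityEq : Pred Point 0ℓ → ℚ → Set
UpperDensityEq X r =
    (∀ ε → 0ℚ < ε → ∃[ N ] ∀ n k → n ≥ N → BoxCount X n k → ratio k n < r + ε)
  × (∀ ε → 0ℚ < ε → ∀ N → ∃[ n ] ∃[ k ] (n ≥ N) × BoxCount X n k × (r - ε < ratio k n))

-- Let p be the interior point of an internal triangle abc, oriented positively, and write
-- u = a − p, v = b − p, w = c − p and α, β, γ for twice the areas of pbc, pca, pab, so that
-- αu + βv + γw = 0. As the only lattice points of the triangle are a, b, c and p, every
-- lattice point written with nonnegative integer barycentric weights is one of them. The
-- reflection −u shows α < β + γ (and cyclically); then the weights (β+γ−α, γ+α−β, α+β−γ)
-- force u + v + w = 0, and the weights (4, 1, 1) show that u, v, w are nonzero modulo 2.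
-- Membership in J½ depends only on residues modulo 4, and a finite check over the residues
-- of a, b, p (with c = 3p − a − b) shows that exactly three of a, b, c, p can never lie in J½.
-- For the density, any four consecutive points of a row contain exactly two points of J½,
-- so the box [−n, n]² contains (2n+1)²/2 + O(n) of them.
module Submission where

open import Algebra.Bundles using (CommutativeMonoid)
import Algebra.Properties.CommutativeSemigroup as CommSemigroupProperties
open import Data.Empty using (⊥; ⊥-elim)
open import Data.Integer as ℤ using (ℤ; +_; -_; _+_; _-_; _*_; _≤_; _<_; +<+; +≤+; 0ℤ; 1ℤ)
open import Data.Integer.DivMod using (_%ℕ_; _/ℕ_; a≡a%ℕn+[a/ℕn]*n; n%ℕd<d)
import Data.Integer.Properties as ℤ
open import Data.Integer.Solver using () renaming (module +-*-Solver to ℤ-Solver)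
open import Data.Integer.Tactic.RingSolver using (solve; solve-∀)
open import Data.List using (List; []; _∷_; _++_; map; upTo; applyUpTo; cartesianProduct; filter; length)
open import Data.List.Membership.Propositional using (_∈_)
open import Data.List.Membership.Propositional.Properties
  using (∈-++⁺ˡ; ∈-++⁺ʳ; ∈-++⁻; ∈-map⁺; ∈-map⁻; ∈-cartesianProduct⁺; ∈-cartesianProduct⁻; ∈-upTo⁺;
         ∈-applyUpTo⁺; ∈-applyUpTo⁻; ∈-filter⁺; ∈-filter⁻; ∈-∃++)
open import Data.List.Properties using (length-++; filter-++; length-filter; length-applyUpTo; map-applyUpTo)
open import Data.List.Relation.Unary.All as All using (All; all?)
open import Data.List.Relation.Unary.AllPairs using (_∷_)
import Data.List.Relation.Unary.Any as Membership
open import Data.List.Relation.Unary.Any using (here; there)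
open import Data.List.Relation.Unary.Unique.Propositional using (Unique)
import Data.List.Relation.Unary.Unique.Propositional.Properties as Unique
open import Data.Nat as ℕ using (ℕ; suc; zero)
import Data.Nat.Coprimality as Coprimality
open import Data.Nat.DivMod using (m≡m%n+[m/n]*n; m%n<n)
import Data.Nat.Properties as ℕ
open import Data.Nat.Tactic.RingSolver using () renaming (solve to solveℕ)
open import Data.Product using (∃-syntax; _×_; _,_; proj₁; proj₂)
open import Data.Product.Properties using (≡-dec)
open import Data.Rational as ℚ using (ℚ; mkℚ; 0ℚ; 1ℚ; _/_)
import Data.Rational.Properties as ℚ
open import Data.Rational.Solver using () renaming (module +-*-Solver to ℚ-Solver)
import Data.Rational.Unnormalised as ℚᵘ
import Data.Rational.Unnormalised.Properties as ℚᵘ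
open import Data.Sum using (_⊎_; inj₁; inj₂)
open import Function using (_∘_)
open import Function.Bundles using (_⇔_; mk⇔; Equivalence)
open import Function.Construct.Identity using (⇔-id)
open import Relation.Binary.Definitions using (tri<; tri≈; tri>)
open import Relation.Binary.PropositionalEquality
open import Relation.Nullary using (¬_; Dec; yes; no)
import Relation.Nullary.Decidable as Dec
open import Relation.Nullary.Decidable using (_×-dec_; _⊎-dec_; ¬?)
open import Relation.Unary using (Decidable)

open import Defs

module ℤ+ = CommSemigroupProperties ℤ.+-commutativeSemigroup
module ℚ+ = CommSemigroupProperties (CommutativeMonoid.commutativeSemigroup ℚ.+-0-commutativeMonoid)

-- Integer and vector algebra

x+y-y≡x : ∀ x y → x + y - y ≡ x
x+y-y≡x = solve-∀

x+y-x≡y : ∀ x y → x + y - x ≡ y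
x+y-x≡y = solve-∀

+-cancelˡ : ∀ s {a b} → s + a ≡ s + b → a ≡ b
+-cancelˡ s {a} {b} eq = trans (sym (x+y-x≡y s a)) (trans (cong (_- s) eq) (x+y-x≡y s b))

t≡2t⇒t≡0 : ∀ {t} → t ≡ + 2 * t → t ≡ 0ℤ
t≡2t⇒t≡0 {t} t≡2t = begin
  t               ≡⟨ solve (t ∷ []) ⟩
  + 2 * t - t     ≡⟨ cong (_- t) t≡2t ⟨
  t - t           ≡⟨ ℤ.+-inverseʳ t ⟩
  0ℤ              ∎
  where open ≡-Reasoning

nonNeg-double : ∀ {t} → 0ℤ < t → 0ℤ ≤ t + t
nonNeg-double 0<t = ℤ.<⇒≤ (ℤ.+-mono-< 0<t 0<t)

positive-sum : ∀ {x y z} → 0ℤ < x → 0ℤ < y → 0ℤ < z → 0ℤ < x + y + z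
positive-sum 0<x 0<y 0<z = ℤ.+-mono-< (ℤ.+-mono-< 0<x 0<y) 0<z

positive⇒≢0 : ∀ {t} → 0ℤ < t → t ≢ 0ℤ
positive⇒≢0 0<t = ℤ.<⇒≢ 0<t ∘ sym

infixl 6 _+ᵥ_ _-ᵥ_
infixr 7 _·_

_+ᵥ_ : Point → Point → Point
(x₁ , y₁) +ᵥ (x₂ , y₂) = (x₁ + x₂ , y₁ + y₂)

_-ᵥ_ : Point → Point → Point
(x₁ , y₁) -ᵥ (x₂ , y₂) = (x₁ - x₂ , y₁ - y₂)

_·_ : ℤ → Point → Point
k · (x , y) = (k * x , k * y)

0ᵥ : Point
0ᵥ = (0ℤ , 0ℤ)

-ᵥ_ : Point → Point
-ᵥ (x , y) = (- x , - y)

cross : Point → Point → ℤ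
cross (x₁ , y₁) (x₂ , y₂) = x₁ * y₂ - y₁ * x₂

area : Point → Point → Point → ℤ
area a b c = cross (b -ᵥ a) (c -ᵥ a)

+ᵥ-rotate : ∀ u v w → u +ᵥ v +ᵥ w ≡ v +ᵥ w +ᵥ u
+ᵥ-rotate (ux , uy) (vx , vy) (wx , wy) = cong₂ _,_ (ℤ+.xy∙z≈yz∙x ux vx wx) (ℤ+.xy∙z≈yz∙x uy vy wy)

+ᵥ-interchange : ∀ p q r → p +ᵥ q +ᵥ r ≡ p +ᵥ r +ᵥ q
+ᵥ-interchange (px , py) (qx , qy) (rx , ry) =
  cong₂ _,_ (ℤ+.xy∙z≈xz∙y px qx rx) (ℤ+.xy∙z≈xz∙y py qy ry)

+ᵥ-cancelʳ : ∀ {z p a} → z +ᵥ p ≡ a → z ≡ a -ᵥ p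
+ᵥ-cancelʳ {zx , zy} {px , py} refl = cong₂ _,_ (sym (x+y-y≡x zx px)) (sym (x+y-y≡x zy py))

-ᵥ-self : ∀ p → p -ᵥ p ≡ 0ᵥ
-ᵥ-self (px , py) = cong₂ _,_ (ℤ.+-inverseʳ px) (ℤ.+-inverseʳ py)

module _ where
  open ℤ-Solver using (_:+_; _:-_; _:*_; :-_; _:=_; con)

  barycentric : ∀ u v w → cross v w · u +ᵥ cross w u · v +ᵥ cross u v · w ≡ 0ᵥ
  barycentric (ux , uy) (vx , vy) (wx , wy) = cong₂ _,_
    (ℤ-Solver.solve 6 (λ ux uy vx vy wx wy →
       (vx :* wy :- vy :* wx) :* ux :+ (wx :* uy :- wy :* ux) :* vx :+ (ux :* vy :- uy :* vx) :* wx
       := con 0ℤ) refl ux uy vx vy wx wy)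
    (ℤ-Solver.solve 6 (λ ux uy vx vy wx wy →
       (vx :* wy :- vy :* wx) :* uy :+ (wx :* uy :- wy :* ux) :* vy :+ (ux :* vy :- uy :* vx) :* wy
       := con 0ℤ) refl ux uy vx vy wx wy)

  cross-negˡ : ∀ u v → cross (-ᵥ u) v ≡ - cross u v
  cross-negˡ (ux , uy) (vx , vy) = ℤ-Solver.solve 4 (λ ux uy vx vy →
    (:- ux) :* vy :- (:- uy) :* vx := :- (ux :* vy :- uy :* vx)) refl ux uy vx vy

  cross-neg-selfʳ : ∀ u → cross u (-ᵥ u) ≡ 0ℤ
  cross-neg-selfʳ (ux , uy) = ℤ-Solver.solve 2 (λ ux uy →
    ux :* (:- uy) :- uy :* (:- ux) := con 0ℤ) refl ux uy

  cross-neg-selfˡ : ∀ u → cross (-ᵥ u) u ≡ 0ℤ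
  cross-neg-selfˡ (ux , uy) = ℤ-Solver.solve 2 (λ ux uy →
    (:- ux) :* uy :- (:- uy) :* ux := con 0ℤ) refl ux uy

  cross-scaledˡ : ∀ k u v → cross (k · u) v ≡ k * cross u v
  cross-scaledˡ k (ux , uy) (vx , vy) = ℤ-Solver.solve 5 (λ k ux uy vx vy →
    (k :* ux) :* vy :- (k :* uy) :* vx := k :* (ux :* vy :- uy :* vx)) refl k ux uy vx vy

  cross-scaled-selfˡ : ∀ k u → cross (k · u) u ≡ 0ℤ
  cross-scaled-selfˡ k (ux , uy) = ℤ-Solver.solve 3 (λ k ux uy →
    (k :* ux) :* uy :- (k :* uy) :* ux := con 0ℤ) refl k ux uy

  cross-scaled-selfʳ : ∀ k u → cross u (k · u) ≡ 0ℤ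
  cross-scaled-selfʳ k (ux , uy) = ℤ-Solver.solve 3 (λ k ux uy →
    ux :* (k :* uy) :- uy :* (k :* ux) := con 0ℤ) refl k ux uy

  cross-via-sum : ∀ u v w → cross v w ≡ cross v (u +ᵥ v +ᵥ w) - cross v u
  cross-via-sum (ux , uy) (vx , vy) (wx , wy) = ℤ-Solver.solve 6 (λ ux uy vx vy wx wy →
    vx :* wy :- vy :* wx := (vx :* (uy :+ vy :+ wy) :- vy :* (ux :+ vx :+ wx)) :- (vx :* uy :- vy :* ux))
    refl ux uy vx vy wx wy

  area-rotate : ∀ a b c → area b c a ≡ area a b c
  area-rotate (ax , ay) (bx , by) (cx , cy) =
    ℤ-Solver.solve 6 (λ ax ay bx by cx cy →
               (cx :- bx) :* (ay :- by) :- (cy :- by) :* (ax :- bx)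
            := (bx :- ax) :* (cy :- ay) :- (by :- ay) :* (cx :- ax)) refl ax ay bx by cx cy

  area-swap : ∀ a b c → area a c b ≡ - area a b c
  area-swap (ax , ay) (bx , by) (cx , cy) =
    ℤ-Solver.solve 6 (λ ax ay bx by cx cy →
               (cx :- ax) :* (by :- ay) :- (cy :- ay) :* (bx :- ax)
            := :- ((bx :- ax) :* (cy :- ay) :- (by :- ay) :* (cx :- ax))) refl ax ay bx by cx cy

reflection-weights : ∀ A B C x y z → A * x + B * y + C * z ≡ 0ℤ →
  (A - (B + C)) * x + (B + B) * y + (C + C) * z ≡ (A - (B + C) + (B + B) + (C + C)) * - x
reflection-weights A B C x y z e = begin
  (A - (B + C)) * x + (B + B) * y + (C + C) * z
    ≡⟨ solve (A ∷ B ∷ C ∷ x ∷ y ∷ z ∷ []) ⟩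
  + 2 * (A * x + B * y + C * z) + (A - (B + C) + (B + B) + (C + C)) * - x
    ≡⟨ cong (λ t → + 2 * t + (A - (B + C) + (B + B) + (C + C)) * - x) e ⟩
  + 2 * 0ℤ + (A - (B + C) + (B + B) + (C + C)) * - x
    ≡⟨ ℤ.+-identityˡ _ ⟩
  (A - (B + C) + (B + B) + (C + C)) * - x ∎
  where open ≡-Reasoning

reflection-weights-sum : ∀ A B C → A + B + C ≡ A - (B + C) + (B + B) + (C + C)
reflection-weights-sum = solve-∀

centroid-weights : ∀ A B C x y z → A * x + B * y + C * z ≡ 0ℤ →
  (B + C - A) * x + (C + A - B) * y + (A + B - C) * z
  ≡ (B + C - A + (C + A - B) + (A + B - C)) * (x + y + z)
centroid-weights A B C x y z e = begin
  (B + C - A) * x + (C + A - B) * y + (A + B - C) * z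
    ≡⟨ solve (A ∷ B ∷ C ∷ x ∷ y ∷ z ∷ []) ⟩
  (B + C - A + (C + A - B) + (A + B - C)) * (x + y + z) - + 2 * (A * x + B * y + C * z)
    ≡⟨ cong (λ t → (B + C - A + (C + A - B) + (A + B - C)) * (x + y + z) - + 2 * t) e ⟩
  (B + C - A + (C + A - B) + (A + B - C)) * (x + y + z) + 0ℤ
    ≡⟨ ℤ.+-identityʳ _ ⟩
  (B + C - A + (C + A - B) + (A + B - C)) * (x + y + z) ∎
  where open ≡-Reasoning

centroid-weights-sum : ∀ A B C → A + B + C ≡ B + C - A + (C + A - B) + (A + B - C)
centroid-weights-sum = solve-∀

midpoint-weights : ∀ x y z k → x + y + z ≡ 0ℤ → x ≡ + 2 * k →
  + 4 * x + + 1 * y + + 1 * z ≡ (+ 4 + + 1 + + 1) * k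
midpoint-weights x y z k sum≡0 x≡2k = begin
  + 4 * x + + 1 * y + + 1 * z ≡⟨ solve (x ∷ y ∷ z ∷ []) ⟩
  + 3 * x + (x + y + z)       ≡⟨ cong (λ t → + 3 * x + t) sum≡0 ⟩
  + 3 * x + 0ℤ                ≡⟨ ℤ.+-identityʳ _ ⟩
  + 3 * x                     ≡⟨ cong (+ 3 *_) x≡2k ⟩
  + 3 * (+ 2 * k)             ≡⟨ solve (k ∷ []) ⟩
  (+ 4 + + 1 + + 1) * k       ∎
  where open ≡-Reasoning

-- Barycentric coordinates

toℚ≡mkℚ : ∀ z → toℚ z ≡ mkℚ z 0 (Coprimality.sym (Coprimality.1-coprimeTo ℤ.∣ z ∣))
toℚ≡mkℚ z = ℚ.↥p/↧p≡p _

toℚ-homo-+ : ∀ x y → toℚ (x + y) ≡ toℚ x ℚ.+ toℚ y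
toℚ-homo-+ x y rewrite toℚ≡mkℚ x | toℚ≡mkℚ y =
  cong (ℚ._/ 1) (cong₂ _+_ (sym (ℤ.*-identityʳ x)) (sym (ℤ.*-identityʳ y)))

toℚ-homo-* : ∀ x y → toℚ (x * y) ≡ toℚ x ℚ.* toℚ y
toℚ-homo-* x y rewrite toℚ≡mkℚ x | toℚ≡mkℚ y = refl

toℚ-homo-neg : ∀ x → toℚ (- x) ≡ ℚ.- toℚ x
toℚ-homo-neg x rewrite toℚ≡mkℚ x | toℚ≡mkℚ (- x) with x
... | + 0        = refl
... | ℤ.+[1+ _ ] = refl
... | ℤ.-[1+ _ ] = refl

toℚ-homo-- : ∀ x y → toℚ (x - y) ≡ toℚ x ℚ.- toℚ y
toℚ-homo-- x y = trans (toℚ-homo-+ x (- y)) (cong (toℚ x ℚ.+_) (toℚ-homo-neg y))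

toℚ-pos⁻ : ∀ z → 0ℚ ℚ.< toℚ z → 0ℤ < z
toℚ-pos⁻ z h rewrite toℚ≡mkℚ z with h
... | ℚ.*<* h′ = subst (0ℤ <_) (ℤ.*-identityʳ z) h′

toℚ-pos⁺ : ∀ z → 0ℤ < z → 0ℚ ℚ.< toℚ z
toℚ-pos⁺ z h rewrite toℚ≡mkℚ z = ℚ.*<* (subst (0ℤ <_) (sym (ℤ.*-identityʳ z)) h)

toℚ-nonNeg⁺ : ∀ z → 0ℤ ≤ z → 0ℚ ℚ.≤ toℚ z
toℚ-nonNeg⁺ z h rewrite toℚ≡mkℚ z = ℚ.*≤* (subst (0ℤ ≤_) (sym (ℤ.*-identityʳ z)) h)

toℚ-linear : ∀ L M N a b c →
  toℚ (L * a + M * b + N * c) ≡ toℚ L ℚ.* toℚ a ℚ.+ toℚ M ℚ.* toℚ b ℚ.+ toℚ N ℚ.* toℚ c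
toℚ-linear L M N a b c rewrite toℚ-homo-+ (L * a + M * b) (N * c) | toℚ-homo-+ (L * a) (M * b)
                             | toℚ-homo-* L a | toℚ-homo-* M b | toℚ-homo-* N c = refl

areaℚ : ℚ → ℚ → ℚ → ℚ → ℚ → ℚ → ℚ
areaℚ ax ay bx by cx cy = (bx ℚ.- ax) ℚ.* (cy ℚ.- ay) ℚ.- (by ℚ.- ay) ℚ.* (cx ℚ.- ax)

toℚ-area : ∀ a b c → toℚ (area a b c) ≡
  areaℚ (toℚ (proj₁ a)) (toℚ (proj₂ a)) (toℚ (proj₁ b)) (toℚ (proj₂ b)) (toℚ (proj₁ c)) (toℚ (proj₂ c))
toℚ-area (ax , ay) (bx , by) (cx , cy)
  rewrite toℚ-homo-- ((bx - ax) * (cy - ay)) ((by - ay) * (cx - ax))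
        | toℚ-homo-* (bx - ax) (cy - ay) | toℚ-homo-* (by - ay) (cx - ax)
        | toℚ-homo-- bx ax | toℚ-homo-- cy ay | toℚ-homo-- by ay | toℚ-homo-- cx ax = refl

areaℚ-barycentric : ∀ l m ax ay bx by cx cy →
  areaℚ (l ℚ.* ax ℚ.+ m ℚ.* bx ℚ.+ (1ℚ ℚ.- l ℚ.- m) ℚ.* cx)
        (l ℚ.* ay ℚ.+ m ℚ.* by ℚ.+ (1ℚ ℚ.- l ℚ.- m) ℚ.* cy) bx by cx cy
  ≡ l ℚ.* areaℚ ax ay bx by cx cy
areaℚ-barycentric = ℚ-Solver.solve 8 (λ l m ax ay bx by cx cy →
  let n = con 1ℚ :- l :- m
      px = l :* ax :+ m :* bx :+ n :* cx
      py = l :* ay :+ m :* by :+ n :* cy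
  in (bx :- px) :* (cy :- py) :- (by :- py) :* (cx :- px)
     := l :* ((bx :- ax) :* (cy :- ay) :- (by :- ay) :* (cx :- ax))) refl
  where open ℚ-Solver using (_:+_; _:-_; _:*_; _:=_; con)

-- Cramer's rule: area p b c is l times area a b c, where l is the coordinate of p at a.
interior-area-pos : ∀ a b c p → InInterior a b c p → 0ℤ < area a b c → 0ℤ < area p b c
interior-area-pos a@(ax , ay) b@(bx , by) c@(cx , cy) p@(px , py)
                  (l , m , n , l>0 , _ , _ , l+m+n≡1 , hx , hy) D>0 =
  toℚ-pos⁻ (area p b c) (subst (0ℚ ℚ.<_) (sym area≡l*area) l*D>0)
  where
  open ≡-Reasoning
  n≡1-l-m : n ≡ 1ℚ ℚ.- l ℚ.- m
  n≡1-l-m = trans (ℚ-Solver.solve 3 (λ l m n → n := l :+ m :+ n :- l :- m) refl l m n)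
                  (cong (λ s → s ℚ.- l ℚ.- m) l+m+n≡1)
    where open ℚ-Solver using (_:+_; _:-_; _:=_)
  eliminate-n : ∀ {x y z w} → l ℚ.* x ℚ.+ m ℚ.* y ℚ.+ n ℚ.* z ≡ w →
                l ℚ.* x ℚ.+ m ℚ.* y ℚ.+ (1ℚ ℚ.- l ℚ.- m) ℚ.* z ≡ w
  eliminate-n {x} {y} {z} {w} = subst (λ n → l ℚ.* x ℚ.+ m ℚ.* y ℚ.+ n ℚ.* z ≡ w) n≡1-l-m
  area≡l*area : toℚ (area p b c) ≡ l ℚ.* toℚ (area a b c)
  area≡l*area = begin
    toℚ (area p b c)
      ≡⟨ toℚ-area p b c ⟩
    areaℚ (toℚ px) (toℚ py) (toℚ bx) (toℚ by) (toℚ cx) (toℚ cy)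
      ≡⟨ cong₂ (λ x y → areaℚ x y (toℚ bx) (toℚ by) (toℚ cx) (toℚ cy))
               (sym (eliminate-n hx)) (sym (eliminate-n hy)) ⟩
    areaℚ (l ℚ.* toℚ ax ℚ.+ m ℚ.* toℚ bx ℚ.+ (1ℚ ℚ.- l ℚ.- m) ℚ.* toℚ cx)
          (l ℚ.* toℚ ay ℚ.+ m ℚ.* toℚ by ℚ.+ (1ℚ ℚ.- l ℚ.- m) ℚ.* toℚ cy)
          (toℚ bx) (toℚ by) (toℚ cx) (toℚ cy)
      ≡⟨ areaℚ-barycentric l m (toℚ ax) (toℚ ay) (toℚ bx) (toℚ by) (toℚ cx) (toℚ cy) ⟩
    l ℚ.* areaℚ (toℚ ax) (toℚ ay) (toℚ bx) (toℚ by) (toℚ cx) (toℚ cy)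
      ≡⟨ cong (l ℚ.*_) (toℚ-area a b c) ⟨
    l ℚ.* toℚ (area a b c) ∎
  l*D>0 : 0ℚ ℚ.< l ℚ.* toℚ (area a b c)
  l*D>0 = ℚ.positive⁻¹ _ {{ℚ.pos*pos⇒pos l {{ℚ.positive l>0}} _ {{ℚ.positive (toℚ-pos⁺ _ D>0)}}}}

InInterior-rotate : ∀ a b c p → InInterior a b c p → InInterior b c a p
InInterior-rotate (ax , ay) (bx , by) (cx , cy) _ (l , m , n , l>0 , m>0 , n>0 , sum , x , y) =
  m , n , l , m>0 , n>0 , l>0 , trans (rotate l m n) sum ,
  trans (rotate (l ℚ.* toℚ ax) _ _) x , trans (rotate (l ℚ.* toℚ ay) _ _) y
  where
  rotate : ∀ x y z → y ℚ.+ z ℚ.+ x ≡ x ℚ.+ y ℚ.+ z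
  rotate x y z = sym (ℚ+.xy∙z≈yz∙x x y z)

InInterior-swap : ∀ a b c p → InInterior a b c p → InInterior a c b p
InInterior-swap (ax , ay) (bx , by) (cx , cy) _ (l , m , n , l>0 , m>0 , n>0 , sum , x , y) =
  l , n , m , l>0 , n>0 , m>0 , trans (ℚ+.xy∙z≈xz∙y l n m) sum ,
  trans (ℚ+.xy∙z≈xz∙y (l ℚ.* toℚ ax) _ _) x , trans (ℚ+.xy∙z≈xz∙y (l ℚ.* toℚ ay) _ _) y

InHull-swap : ∀ a b c q → InHull a b c q → InHull a c b q
InHull-swap (ax , ay) (bx , by) (cx , cy) _ (l , m , n , l≥0 , m≥0 , n≥0 , sum , x , y) =
  l , n , m , l≥0 , n≥0 , m≥0 , trans (ℚ+.xy∙z≈xz∙y l n m) sum ,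
  trans (ℚ+.xy∙z≈xz∙y (l ℚ.* toℚ ax) _ _) x , trans (ℚ+.xy∙z≈xz∙y (l ℚ.* toℚ ay) _ _) y

interior-areas-pos : ∀ a b c p → InInterior a b c p → 0ℤ < area a b c →
  (0ℤ < area p b c) × (0ℤ < area p c a) × (0ℤ < area p a b)
interior-areas-pos a b c p int D>0 =
  interior-area-pos a b c p int D>0 ,
  interior-area-pos b c a p int′ (subst (0ℤ <_) (sym (area-rotate a b c)) D>0) ,
  interior-area-pos c a b p (InInterior-rotate b c a p int′)
    (subst (0ℤ <_) (sym (trans (area-rotate b c a) (area-rotate a b c))) D>0)
  where
  int′ : InInterior b c a p
  int′ = InInterior-rotate a b c p int

LatticeHull : Point → Point → Point → Point → Set
LatticeHull a b c q = ∃[ L ] ∃[ M ] ∃[ N ]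
  (0ℤ ≤ L) × (0ℤ ≤ M) × (0ℤ ≤ N) × (0ℤ < L + M + N)
  × (L · a +ᵥ M · b +ᵥ N · c ≡ (L + M + N) · q)

LatticeHull⇒InHull : ∀ a b c q → LatticeHull a b c q → InHull a b c q
LatticeHull⇒InHull (ax , ay) (bx , by) (cx , cy) (qx , qy) (L , M , N , L≥0 , M≥0 , N≥0 , W>0 , eq) =
  weight L , weight M , weight N , weight≥0 L≥0 , weight≥0 M≥0 , weight≥0 N≥0 ,
  weights-sum , coordinate (cong proj₁ eq) , coordinate (cong proj₂ eq)
  where
  open ℚ-Solver using (_:+_; _:*_; _:=_)
  W : ℤ
  W = L + M + N
  instance
    W-pos : ℚ.Positive (toℚ W)
    W-pos = ℚ.positive (toℚ-pos⁺ W W>0)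
    W-nonZero : ℚ.NonZero (toℚ W)
    W-nonZero = ℚ.pos⇒nonZero (toℚ W)
  r : ℚ
  r = ℚ.1/ toℚ W
  weight : ℤ → ℚ
  weight X = toℚ X ℚ.* r
  weight≥0 : ∀ {X} → 0ℤ ≤ X → 0ℚ ℚ.≤ weight X
  weight≥0 {X} X≥0 = ℚ.nonNegative⁻¹ _
    {{ℚ.nonNeg*nonNeg⇒nonNeg (toℚ X) {{ℚ.nonNegative (toℚ-nonNeg⁺ X X≥0)}} r
                           {{ℚ.pos⇒nonNeg r {{ℚ.1/pos⇒pos (toℚ W)}}}}}}
  toℚW : toℚ W ≡ toℚ L ℚ.+ toℚ M ℚ.+ toℚ N
  toℚW = trans (toℚ-homo-+ (L + M) N) (cong (ℚ._+ toℚ N) (toℚ-homo-+ L M))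
  weights-sum : weight L ℚ.+ weight M ℚ.+ weight N ≡ 1ℚ
  weights-sum = trans (ℚ-Solver.solve 4 (λ L M N r → L :* r :+ M :* r :+ N :* r := (L :+ M :+ N) :* r) refl
                                 (toℚ L) (toℚ M) (toℚ N) r)
                      (trans (cong (ℚ._* r) (sym toℚW)) (ℚ.*-inverseʳ (toℚ W)))
  coordinate : ∀ {a b c q} → L * a + M * b + N * c ≡ W * q →
               weight L ℚ.* toℚ a ℚ.+ weight M ℚ.* toℚ b ℚ.+ weight N ℚ.* toℚ c ≡ toℚ q
  coordinate {a} {b} {c} {q} e = begin
    weight L ℚ.* toℚ a ℚ.+ weight M ℚ.* toℚ b ℚ.+ weight N ℚ.* toℚ c
      ≡⟨ ℚ-Solver.solve 8 (λ L M N r a b c q → L :* r :* a :+ M :* r :* b :+ N :* r :* c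
                                      := r :* (L :* a :+ M :* b :+ N :* c)) refl
               (toℚ L) (toℚ M) (toℚ N) r (toℚ a) (toℚ b) (toℚ c) (toℚ q) ⟩
    r ℚ.* (toℚ L ℚ.* toℚ a ℚ.+ toℚ M ℚ.* toℚ b ℚ.+ toℚ N ℚ.* toℚ c)
      ≡⟨ cong (r ℚ.*_) (toℚ-linear L M N a b c) ⟨
    r ℚ.* toℚ (L * a + M * b + N * c)
      ≡⟨ cong (λ z → r ℚ.* toℚ z) e ⟩
    r ℚ.* toℚ (W * q)
      ≡⟨ cong (r ℚ.*_) (toℚ-homo-* W q) ⟩
    r ℚ.* (toℚ W ℚ.* toℚ q)
      ≡⟨ ℚ-Solver.solve 3 (λ r w q → r :* (w :* q) := (w :* r) :* q) refl r (toℚ W) (toℚ q) ⟩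
    (toℚ W ℚ.* r) ℚ.* toℚ q
      ≡⟨ cong (ℚ._* toℚ q) (ℚ.*-inverseʳ (toℚ W)) ⟩
    1ℚ ℚ.* toℚ q
      ≡⟨ ℚ.*-identityˡ (toℚ q) ⟩
    toℚ q ∎
    where open ≡-Reasoning

-- Internal triangles around the origin

Even : Point → Set
Even u = ∃[ k ] u ≡ + 2 · k

OneOf : Point → Point → Point → Point → Point → Set
OneOf q a b c p = q ≡ a ⊎ q ≡ b ⊎ q ≡ c ⊎ q ≡ p

-- An internal triangle translated so that its interior point is the origin, positively oriented.
record EmptyAroundOrigin (u v w : Point) : Set where
  field
    lattice-points : ∀ z → LatticeHull u v w z → OneOf z u v w 0ᵥ
    0<vw : 0ℤ < cross v w
    0<wu : 0ℤ < cross w u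
    0<uv : 0ℤ < cross u v

LatticeHull-rotate : ∀ u v w z → LatticeHull v w u z → LatticeHull u v w z
LatticeHull-rotate (ux , uy) (vx , vy) (wx , wy) (zx , zy) (L , M , N , L≥0 , M≥0 , N≥0 , W>0 , eq) =
  N , L , M , N≥0 , L≥0 , M≥0 , subst (0ℤ <_) (sym (ℤ+.xy∙z≈yz∙x N L M)) W>0 ,
  cong₂ _,_ (coordinate (cong proj₁ eq)) (coordinate (cong proj₂ eq))
  where
  coordinate : ∀ {x y z q} → L * y + M * z + N * x ≡ (L + M + N) * q →
               N * x + L * y + M * z ≡ (N + L + M) * q
  coordinate {x} {y} {z} {q} e =
    trans (ℤ+.xy∙z≈yz∙x (N * x) (L * y) (M * z)) (trans e (cong (_* q) (sym (ℤ+.xy∙z≈yz∙x N L M))))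

rotate : ∀ {u v w} → EmptyAroundOrigin u v w → EmptyAroundOrigin v w u
rotate {u} {v} {w} E = record
  { lattice-points = λ z h → rotate-OneOf (lattice-points z (LatticeHull-rotate u v w z h))
  ; 0<vw = 0<wu
  ; 0<wu = 0<uv
  ; 0<uv = 0<vw
  }
  where
  open EmptyAroundOrigin E
  rotate-OneOf : ∀ {z} → OneOf z u v w 0ᵥ → OneOf z v w u 0ᵥ
  rotate-OneOf (inj₁ z≡u)                = inj₂ (inj₂ (inj₁ z≡u))
  rotate-OneOf (inj₂ (inj₁ z≡v))         = inj₁ z≡v
  rotate-OneOf (inj₂ (inj₂ (inj₁ z≡w)))  = inj₂ (inj₁ z≡w)
  rotate-OneOf (inj₂ (inj₂ (inj₂ z≡0)))  = inj₂ (inj₂ (inj₂ z≡0))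

LatticeHull-translate : ∀ a b c p z → LatticeHull (a -ᵥ p) (b -ᵥ p) (c -ᵥ p) z → LatticeHull a b c (z +ᵥ p)
LatticeHull-translate (ax , ay) (bx , by) (cx , cy) (px , py) (zx , zy) (L , M , N , L≥0 , M≥0 , N≥0 , W>0 , eq) =
  L , M , N , L≥0 , M≥0 , N≥0 , W>0 , cong₂ _,_ (coordinate (cong proj₁ eq)) (coordinate (cong proj₂ eq))
  where
  open ≡-Reasoning
  coordinate : ∀ {a b c p z} → L * (a - p) + M * (b - p) + N * (c - p) ≡ (L + M + N) * z →
               L * a + M * b + N * c ≡ (L + M + N) * (z + p)
  coordinate {a} {b} {c} {p} {z} e = begin
    L * a + M * b + N * c
      ≡⟨ solve (L ∷ M ∷ N ∷ a ∷ b ∷ c ∷ p ∷ []) ⟩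
    (L * (a - p) + M * (b - p) + N * (c - p)) + (L + M + N) * p
      ≡⟨ cong (_+ (L + M + N) * p) e ⟩
    (L + M + N) * z + (L + M + N) * p
      ≡⟨ ℤ.*-distribˡ-+ (L + M + N) z p ⟨
    (L + M + N) * (z + p) ∎

-- Write α, β, γ for cross v w, cross w u, cross u v. If β + γ ≤ α, the weights (α − β − γ, 2β, 2γ)
-- make the reflection −u a lattice point of the triangle.
triangle-inequality : ∀ {u v w} → EmptyAroundOrigin u v w → cross v w < cross w u + cross u v
triangle-inequality {u@(ux , uy)} {v@(vx , vy)} {w@(wx , wy)} E = ℤ.≰⇒> reflection-not-inside
  where
  open EmptyAroundOrigin E
  open ≡-Reasoning
  α β γ : ℤ
  α = cross v w
  β = cross w u
  γ = cross u v
  reflection-in-hull : β + γ ≤ α → LatticeHull u v w (-ᵥ u)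
  reflection-in-hull β+γ≤α =
    α - (β + γ) , β + β , γ + γ , ℤ.i≤j⇒0≤j-i β+γ≤α , nonNeg-double 0<wu , nonNeg-double 0<uv ,
    subst (0ℤ <_) (reflection-weights-sum α β γ) (positive-sum 0<vw 0<wu 0<uv) ,
    cong₂ _,_ (reflection-weights α β γ ux vx wx (cong proj₁ (barycentric u v w)))
              (reflection-weights α β γ uy vy wy (cong proj₂ (barycentric u v w)))
  reflection-not-vertex : ¬ OneOf (-ᵥ u) u v w 0ᵥ
  reflection-not-vertex (inj₁ -u≡u) = positive⇒≢0 (ℤ.+-mono-< 0<uv 0<uv) (begin
    γ + γ              ≡⟨ cong (λ t → cross t v + γ) -u≡u ⟨
    cross (-ᵥ u) v + γ ≡⟨ cong (_+ γ) (cross-negˡ u v) ⟩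
    - γ + γ            ≡⟨ ℤ.+-inverseˡ γ ⟩
    0ℤ                 ∎)
  reflection-not-vertex (inj₂ (inj₁ -u≡v)) =
    positive⇒≢0 0<uv (trans (cong (cross u) (sym -u≡v)) (cross-neg-selfʳ u))
  reflection-not-vertex (inj₂ (inj₂ (inj₁ -u≡w))) =
    positive⇒≢0 0<wu (trans (cong (λ t → cross t u) (sym -u≡w)) (cross-neg-selfˡ u))
  reflection-not-vertex (inj₂ (inj₂ (inj₂ -u≡0))) = positive⇒≢0 0<uv (begin
    γ                  ≡⟨ ℤ.neg-involutive γ ⟨
    - - γ              ≡⟨ cong -_ (cross-negˡ u v) ⟨
    - cross (-ᵥ u) v   ≡⟨ cong (λ t → - cross t v) -u≡0 ⟩
    0ℤ                 ∎)
  reflection-not-inside : ¬ (β + γ ≤ α)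
  reflection-not-inside β+γ≤α = reflection-not-vertex (lattice-points (-ᵥ u) (reflection-in-hull β+γ≤α))

sum≢first-vertex : ∀ u v w → 0ℤ < cross v w → u +ᵥ v +ᵥ w ≢ u
sum≢first-vertex u v w 0<vw sum≡u = positive⇒≢0 0<vw (begin
  cross v w                              ≡⟨ cross-via-sum u v w ⟩
  cross v (u +ᵥ v +ᵥ w) - cross v u      ≡⟨ cong (λ t → cross v t - cross v u) sum≡u ⟩
  cross v u - cross v u                  ≡⟨ ℤ.+-inverseʳ (cross v u) ⟩
  0ℤ                                     ∎)
  where open ≡-Reasoning

-- The weights (β + γ − α, γ + α − β, α + β − γ) are nonnegative by the triangle inequalities
-- and make u + v + w a lattice point of the triangle; it can only be the origin.
centroid : ∀ {u v w} → EmptyAroundOrigin u v w → u +ᵥ v +ᵥ w ≡ 0ᵥ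
centroid {u@(ux , uy)} {v@(vx , vy)} {w@(wx , wy)} E =
  sum-is-origin (lattice-points (u +ᵥ v +ᵥ w) sum-in-hull)
  where
  open EmptyAroundOrigin E
  α β γ : ℤ
  α = cross v w
  β = cross w u
  γ = cross u v
  nonNeg-weight : ∀ A B C → A < B + C → 0ℤ ≤ B + C - A
  nonNeg-weight _ _ _ A<B+C = ℤ.i≤j⇒0≤j-i (ℤ.<⇒≤ A<B+C)
  sum-in-hull : LatticeHull u v w (u +ᵥ v +ᵥ w)
  sum-in-hull =
    β + γ - α , γ + α - β , α + β - γ ,
    nonNeg-weight α β γ (triangle-inequality E) ,
    nonNeg-weight β γ α (triangle-inequality (rotate E)) ,
    nonNeg-weight γ α β (triangle-inequality (rotate (rotate E))) ,
    subst (0ℤ <_) (centroid-weights-sum α β γ) (positive-sum 0<vw 0<wu 0<uv) ,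
    cong₂ _,_ (centroid-weights α β γ ux vx wx (cong proj₁ (barycentric u v w)))
              (centroid-weights α β γ uy vy wy (cong proj₂ (barycentric u v w)))
  sum-is-origin : OneOf (u +ᵥ v +ᵥ w) u v w 0ᵥ → u +ᵥ v +ᵥ w ≡ 0ᵥ
  sum-is-origin (inj₁ sum≡u) = ⊥-elim (sum≢first-vertex u v w 0<vw sum≡u)
  sum-is-origin (inj₂ (inj₁ sum≡v)) =
    ⊥-elim (sum≢first-vertex v w u 0<wu (trans (sym (+ᵥ-rotate u v w)) sum≡v))
  sum-is-origin (inj₂ (inj₂ (inj₁ sum≡w))) =
    ⊥-elim (sum≢first-vertex w u v 0<uv (trans (sym (trans (+ᵥ-rotate u v w) (+ᵥ-rotate v w u))) sum≡w))
  sum-is-origin (inj₂ (inj₂ (inj₂ sum≡0))) = sum≡0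

-- If u = 2k then, since v + w = −u, the weights (4, 1, 1) make k a lattice point of the triangle.
not-even : ∀ {u v w} → EmptyAroundOrigin u v w → ¬ Even u
not-even {u@(ux , uy)} {v@(vx , vy)} {w@(wx , wy)} E (k@(kx , ky) , u≡2k) =
  midpoint-not-vertex (lattice-points k midpoint-in-hull)
  where
  open EmptyAroundOrigin E
  open ≡-Reasoning
  midpoint-in-hull : LatticeHull u v w k
  midpoint-in-hull =
    + 4 , + 1 , + 1 , +≤+ ℕ.z≤n , +≤+ ℕ.z≤n , +≤+ ℕ.z≤n , +<+ (ℕ.s≤s ℕ.z≤n) ,
    cong₂ _,_ (midpoint-weights ux vx wx kx (cong proj₁ (centroid E)) (cong proj₁ u≡2k))
              (midpoint-weights uy vy wy ky (cong proj₂ (centroid E)) (cong proj₂ u≡2k))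
  midpoint-not-vertex : ¬ OneOf k u v w 0ᵥ
  midpoint-not-vertex (inj₁ k≡u) = positive⇒≢0 0<uv (t≡2t⇒t≡0 (begin
    cross u v                   ≡⟨ cong (λ t → cross t v) u≡2k ⟩
    cross (+ 2 · k) v           ≡⟨ cong (λ t → cross (+ 2 · t) v) k≡u ⟩
    cross (+ 2 · u) v           ≡⟨ cross-scaledˡ (+ 2) u v ⟩
    + 2 * cross u v             ∎))
  midpoint-not-vertex (inj₂ (inj₁ k≡v)) = positive⇒≢0 0<uv (begin
    cross u v                   ≡⟨ cong (λ t → cross t v) u≡2k ⟩
    cross (+ 2 · k) v           ≡⟨ cong (λ t → cross (+ 2 · t) v) k≡v ⟩
    cross (+ 2 · v) v           ≡⟨ cross-scaled-selfˡ (+ 2) v ⟩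
    0ℤ                          ∎)
  midpoint-not-vertex (inj₂ (inj₂ (inj₁ k≡w))) = positive⇒≢0 0<wu (begin
    cross w u                   ≡⟨ cong (cross w) u≡2k ⟩
    cross w (+ 2 · k)           ≡⟨ cong (λ t → cross w (+ 2 · t)) k≡w ⟩
    cross w (+ 2 · w)           ≡⟨ cross-scaled-selfʳ (+ 2) w ⟩
    0ℤ                          ∎)
  midpoint-not-vertex (inj₂ (inj₂ (inj₂ k≡0))) = positive⇒≢0 0<uv (begin
    cross u v                   ≡⟨ cong (λ t → cross t v) u≡2k ⟩
    cross (+ 2 · k) v           ≡⟨ cong (λ t → cross (+ 2 · t) v) k≡0 ⟩
    cross (+ 2 · 0ᵥ) v          ≡⟨⟩
    0ℤ                          ∎)

internal⇒EmptyAroundOrigin : ∀ a b c p → InternalTriangle a b c p → 0ℤ < area a b c →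
  EmptyAroundOrigin (a -ᵥ p) (b -ᵥ p) (c -ᵥ p)
internal⇒EmptyAroundOrigin a b c p (_ , interior , hull) 0<D = record
  { lattice-points = λ z h →
      translate-back (hull (z +ᵥ p) (LatticeHull⇒InHull a b c (z +ᵥ p) (LatticeHull-translate a b c p z h)))
  ; 0<vw = proj₁ areas
  ; 0<wu = proj₁ (proj₂ areas)
  ; 0<uv = proj₂ (proj₂ areas)
  }
  where
  areas : (0ℤ < area p b c) × (0ℤ < area p c a) × (0ℤ < area p a b)
  areas = interior-areas-pos a b c p interior 0<D
  translate-back : ∀ {z} → OneOf (z +ᵥ p) a b c p → OneOf z (a -ᵥ p) (b -ᵥ p) (c -ᵥ p) 0ᵥ
  translate-back (inj₁ e)                = inj₁ (+ᵥ-cancelʳ e)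
  translate-back (inj₂ (inj₁ e))         = inj₂ (inj₁ (+ᵥ-cancelʳ e))
  translate-back (inj₂ (inj₂ (inj₁ e)))  = inj₂ (inj₂ (inj₁ (+ᵥ-cancelʳ e)))
  translate-back (inj₂ (inj₂ (inj₂ e)))  = inj₂ (inj₂ (inj₂ (trans (+ᵥ-cancelʳ e) (-ᵥ-self p))))

-- Residues modulo 4

below-next-multiple : ∀ {d s t j j′} → s ℕ.< d → j < j′ → + s + j * + d < + t + j′ * + d
below-next-multiple {d} {s} {t} {j} {j′} s<d j<j′ = ℤ.<-≤-trans (ℤ.+-monoˡ-< (j * + d) (+<+ s<d)) (begin
  + d + j * + d      ≡⟨ cong (_+ j * + d) (ℤ.*-identityˡ (+ d)) ⟨
  1ℤ * + d + j * + d ≡⟨ ℤ.*-distribʳ-+ (+ d) 1ℤ j ⟨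
  ℤ.suc j * + d      ≤⟨ ℤ.*-monoʳ-≤-nonNeg (+ d) (ℤ.i<j⇒suc[i]≤j j<j′) ⟩
  j′ * + d           ≤⟨ ℤ.i≤j+i (j′ * + d) (+ t) ⟩
  + t + j′ * + d     ∎)
  where open ℤ.≤-Reasoning

remainder-unique : ∀ {d r r′} k k′ → r ℕ.< d → r′ ℕ.< d →
                   + r + k * + d ≡ + r′ + k′ * + d → r ≡ r′
remainder-unique {d} {r} {r′} k k′ r<d r′<d eq with ℤ.<-cmp k k′
... | tri< k<k′ _ _ = ⊥-elim (ℤ.<-irrefl eq (below-next-multiple r<d k<k′))
... | tri≈ _ refl _ = ℤ.+-injective (begin
  + r                         ≡⟨ x+y-y≡x (+ r) (k * + d) ⟨
  + r + k * + d - k * + d     ≡⟨ cong (_- k * + d) eq ⟩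
  + r′ + k * + d - k * + d    ≡⟨ x+y-y≡x (+ r′) (k * + d) ⟩
  + r′                        ∎)
  where open ≡-Reasoning
... | tri> _ _ k′<k = ⊥-elim (ℤ.<-irrefl (sym eq) (below-next-multiple r′<d k′<k))

%ℕ-periodic : ∀ x k d .{{_ : ℕ.NonZero d}} → (x + k * + d) %ℕ d ≡ x %ℕ d
%ℕ-periodic x k d = remainder-unique ((x + k * + d) /ℕ d) (x /ℕ d + k)
  (n%ℕd<d (x + k * + d) d) (n%ℕd<d x d) (begin
  + ((x + k * + d) %ℕ d) + (x + k * + d) /ℕ d * + d ≡⟨ a≡a%ℕn+[a/ℕn]*n (x + k * + d) d ⟨
  x + k * + d                                      ≡⟨ cong (_+ k * + d) (a≡a%ℕn+[a/ℕn]*n x d) ⟩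
  + (x %ℕ d) + x /ℕ d * + d + k * + d              ≡⟨ ℤ.+-assoc (+ (x %ℕ d)) (x /ℕ d * + d) (k * + d) ⟩
  + (x %ℕ d) + (x /ℕ d * + d + k * + d)            ≡⟨ cong (_+_ (+ (x %ℕ d))) (ℤ.*-distribʳ-+ (+ d) (x /ℕ d) k) ⟨
  + (x %ℕ d) + (x /ℕ d + k) * + d                  ∎)
  where open ≡-Reasoning

residue : ℤ → ℤ
residue x = + (x %ℕ 4)

decompose : ∀ x → x ≡ residue x + + 4 * (x /ℕ 4)
decompose x = trans (a≡a%ℕn+[a/ℕn]*n x 4) (cong (_+_ (residue x)) (ℤ.*-comm (x /ℕ 4) (+ 4)))

residue-periodic : ∀ x k → residue (x + + 4 * k) ≡ residue x
residue-periodic x k = cong +_ (trans (cong (λ t → (x + t) %ℕ 4) (ℤ.*-comm (+ 4) k)) (%ℕ-periodic x k 4))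

same-residue : ∀ x y → residue x ≡ residue y → x ≡ y + + 4 * (x /ℕ 4 - y /ℕ 4)
same-residue x y eq = begin
  x                                            ≡⟨ decompose x ⟩
  residue x + + 4 * (x /ℕ 4)                   ≡⟨ cong (_+ + 4 * (x /ℕ 4)) eq ⟩
  residue y + + 4 * (x /ℕ 4)                   ≡⟨ shift (residue y) (x /ℕ 4) (y /ℕ 4) ⟩
  residue y + + 4 * (y /ℕ 4) + + 4 * (x /ℕ 4 - y /ℕ 4) ≡⟨ cong (_+ + 4 * (x /ℕ 4 - y /ℕ 4)) (decompose y) ⟨
  y + + 4 * (x /ℕ 4 - y /ℕ 4)                  ∎
  where
  open ≡-Reasoning
  shift : ∀ r q q′ → r + + 4 * q ≡ r + + 4 * q′ + + 4 * (q - q′)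
  shift = solve-∀

ρ : Point → Point
ρ (x , y) = (residue x , residue y)

quotient : Point → Point
quotient (x , y) = (x /ℕ 4 , y /ℕ 4)

ρ-periodic : ∀ p k → ρ (p +ᵥ + 4 · k) ≡ ρ p
ρ-periodic (x , y) (k , j) = cong₂ _,_ (residue-periodic x k) (residue-periodic y j)

same-ρ : ∀ p q → ρ p ≡ ρ q → p ≡ q +ᵥ + 4 · (quotient p -ᵥ quotient q)
same-ρ (px , py) (qx , qy) eq = cong₂ _,_ (same-residue px qx (cong proj₁ eq)) (same-residue py qy (cong proj₂ eq))

even-coordinate : ∀ x → (∃[ k ] x ≡ + 2 * k) ⇔ (x %ℕ 2 ≡ 0)
even-coordinate x = mk⇔ to from
  where
  to : ∃[ k ] x ≡ + 2 * k → x %ℕ 2 ≡ 0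
  to (k , refl) = trans (cong (_%ℕ 2) (trans (ℤ.*-comm (+ 2) k) (sym (ℤ.+-identityˡ (k * + 2)))))
                        (%ℕ-periodic 0ℤ k 2)
  from : x %ℕ 2 ≡ 0 → ∃[ k ] x ≡ + 2 * k
  from x%2≡0 = x /ℕ 2 , (begin
    x                            ≡⟨ a≡a%ℕn+[a/ℕn]*n x 2 ⟩
    + (x %ℕ 2) + x /ℕ 2 * + 2    ≡⟨ cong (λ r → + r + x /ℕ 2 * + 2) x%2≡0 ⟩
    0ℤ + x /ℕ 2 * + 2            ≡⟨ ℤ.+-identityˡ _ ⟩
    x /ℕ 2 * + 2                 ≡⟨ ℤ.*-comm (x /ℕ 2) (+ 2) ⟩
    + 2 * (x /ℕ 2)               ∎)
    where open ≡-Reasoning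

Even? : Decidable Even
Even? (x , y) = Dec.map′ from to (x %ℕ 2 ℕ.≟ 0 ×-dec y %ℕ 2 ℕ.≟ 0)
  where
  from : (x %ℕ 2 ≡ 0) × (y %ℕ 2 ≡ 0) → Even (x , y)
  from (x%2≡0 , y%2≡0) with Equivalence.from (even-coordinate x) x%2≡0 | Equivalence.from (even-coordinate y) y%2≡0
  ... | k , x≡2k | j , y≡2j = (k , j) , cong₂ _,_ x≡2k y≡2j
  to : Even (x , y) → (x %ℕ 2 ≡ 0) × (y %ℕ 2 ≡ 0)
  to ((k , j) , eq) = Equivalence.to (even-coordinate x) (k , cong proj₁ eq) ,
                      Equivalence.to (even-coordinate y) (j , cong proj₂ eq)

even-from-residues : ∀ p q → Even (ρ p -ᵥ ρ q) → Even (p -ᵥ q)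
even-from-residues (px , py) (qx , qy) ((h , i) , eq) =
  (h + + 2 * (px /ℕ 4 - qx /ℕ 4) , i + + 2 * (py /ℕ 4 - qy /ℕ 4)) ,
  cong₂ _,_ (coordinate px qx h (cong proj₁ eq)) (coordinate py qy i (cong proj₂ eq))
  where
  open ≡-Reasoning
  regroup : ∀ r s m n → r + + 4 * m - (s + + 4 * n) ≡ r - s + + 2 * (+ 2 * (m - n))
  regroup = solve-∀
  coordinate : ∀ x y h → residue x - residue y ≡ + 2 * h →
               x - y ≡ + 2 * (h + + 2 * (x /ℕ 4 - y /ℕ 4))
  coordinate x y h eq = begin
    x - y
      ≡⟨ cong₂ _-_ (decompose x) (decompose y) ⟩
    residue x + + 4 * (x /ℕ 4) - (residue y + + 4 * (y /ℕ 4))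
      ≡⟨ regroup (residue x) (residue y) (x /ℕ 4) (y /ℕ 4) ⟩
    residue x - residue y + + 2 * (+ 2 * (x /ℕ 4 - y /ℕ 4))
      ≡⟨ cong (_+ + 2 * (+ 2 * (x /ℕ 4 - y /ℕ 4))) eq ⟩
    + 2 * h + + 2 * (+ 2 * (x /ℕ 4 - y /ℕ 4))
      ≡⟨ ℤ.*-distribˡ-+ (+ 2) h _ ⟨
    + 2 * (h + + 2 * (x /ℕ 4 - y /ℕ 4)) ∎

residue-of-third : ∀ a b c p → (a - p) + (b - p) + (c - p) ≡ 0ℤ →
  residue c ≡ residue (+ 3 * residue p - residue a - residue b)
residue-of-third a b c p sum≡0 = begin
  residue c
    ≡⟨ cong residue c≡ ⟩
  residue (+ 3 * residue p - residue a - residue b + + 4 * (+ 3 * (p /ℕ 4) - a /ℕ 4 - b /ℕ 4))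
    ≡⟨ residue-periodic (+ 3 * residue p - residue a - residue b) (+ 3 * (p /ℕ 4) - a /ℕ 4 - b /ℕ 4) ⟩
  residue (+ 3 * residue p - residue a - residue b) ∎
  where
  open ≡-Reasoning
  regroup : ∀ {p a b} rp qp ra qa rb qb → p ≡ rp + + 4 * qp → a ≡ ra + + 4 * qa → b ≡ rb + + 4 * qb →
    + 3 * p - a - b ≡ + 3 * rp - ra - rb + + 4 * (+ 3 * qp - qa - qb)
  regroup rp qp ra qa rb qb refl refl refl = solve (rp ∷ qp ∷ ra ∷ qa ∷ rb ∷ qb ∷ [])
  c≡ : c ≡ + 3 * residue p - residue a - residue b + + 4 * (+ 3 * (p /ℕ 4) - a /ℕ 4 - b /ℕ 4)
  c≡ = begin
    c
      ≡⟨ solve (a ∷ b ∷ c ∷ p ∷ []) ⟩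
    (a - p) + (b - p) + (c - p) + (+ 3 * p - a - b)
      ≡⟨ cong (_+ (+ 3 * p - a - b)) sum≡0 ⟩
    0ℤ + (+ 3 * p - a - b)
      ≡⟨ ℤ.+-identityˡ _ ⟩
    + 3 * p - a - b
      ≡⟨ regroup (residue p) (p /ℕ 4) (residue a) (a /ℕ 4) (residue b) (b /ℕ 4)
                 (decompose p) (decompose a) (decompose b) ⟩
    + 3 * residue p - residue a - residue b + + 4 * (+ 3 * (p /ℕ 4) - a /ℕ 4 - b /ℕ 4) ∎

third-residue : Point → Point → Point → Point
third-residue ra rb rp = ρ (+ 3 · rp -ᵥ ra -ᵥ rb)

ρ-of-third : ∀ a b c p → (a -ᵥ p) +ᵥ (b -ᵥ p) +ᵥ (c -ᵥ p) ≡ 0ᵥ → ρ c ≡ third-residue (ρ a) (ρ b) (ρ p)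
ρ-of-third (ax , ay) (bx , by) (cx , cy) (px , py) eq =
  cong₂ _,_ (residue-of-third ax bx cx px (cong proj₁ eq)) (residue-of-third ay by cy py (cong proj₂ eq))

Δ₀-points : List Point
Δ₀-points = (+ 0 , + 0) ∷ (+ 1 , + 0) ∷ (+ 0 , + 1) ∷ (- + 1 , - + 1) ∷ []

J½-representatives : List Point
J½-representatives = Δ₀-points ++ map (_+ᵥ (+ 2 , + 2)) Δ₀-points

J½-residues : List Point
J½-residues = map ρ J½-representatives

Δ₀⇒∈ : ∀ {d} → Δ₀ d → d ∈ Δ₀-points
Δ₀⇒∈ (inj₁ refl)                = here refl
Δ₀⇒∈ (inj₂ (inj₁ refl))         = there (here refl)
Δ₀⇒∈ (inj₂ (inj₂ (inj₁ refl)))  = there (there (here refl))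
Δ₀⇒∈ (inj₂ (inj₂ (inj₂ refl)))  = there (there (there (here refl)))

∈⇒Δ₀ : ∀ {d} → d ∈ Δ₀-points → Δ₀ d
∈⇒Δ₀ (here refl)                          = inj₁ refl
∈⇒Δ₀ (there (here refl))                  = inj₂ (inj₁ refl)
∈⇒Δ₀ (there (there (here refl)))          = inj₂ (inj₂ (inj₁ refl))
∈⇒Δ₀ (there (there (there (here refl))))  = inj₂ (inj₂ (inj₂ refl))

J½⇒representative : ∀ {p} → J½ p → ∃[ d ] ∃[ k ] d ∈ J½-representatives × p ≡ d +ᵥ + 4 · k
J½⇒representative (inj₁ (d , u , v , d∈Δ₀ , refl , refl)) =
  d , (u , v) , ∈-++⁺ˡ (Δ₀⇒∈ d∈Δ₀) , refl
J½⇒representative (inj₂ (_ , (d , u , v , d∈Δ₀ , refl , refl) , refl)) =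
  d +ᵥ (+ 2 , + 2) , (u , v) , ∈-++⁺ʳ Δ₀-points (∈-map⁺ (_+ᵥ (+ 2 , + 2)) (Δ₀⇒∈ d∈Δ₀)) ,
  +ᵥ-interchange d (+ 4 · (u , v)) (+ 2 , + 2)

representative⇒J½ : ∀ {d} k → d ∈ J½-representatives → J½ (d +ᵥ + 4 · k)
representative⇒J½ {d} k@(u , v) d∈ with ∈-++⁻ Δ₀-points d∈
... | inj₁ d∈Δ₀ = inj₁ (d , u , v , ∈⇒Δ₀ d∈Δ₀ , refl , refl)
... | inj₂ d∈shifted with ∈-map⁻ (_+ᵥ (+ 2 , + 2)) d∈shifted
...   | d₀ , d₀∈Δ₀ , refl = inj₂ (d₀ +ᵥ + 4 · k , (d₀ , u , v , ∈⇒Δ₀ d₀∈Δ₀ , refl , refl) ,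
                                  +ᵥ-interchange d₀ (+ 2 , + 2) (+ 4 · k))

J½⇔residue : ∀ p → J½ p ⇔ ρ p ∈ J½-residues
J½⇔residue p = mk⇔ to from
  where
  to : J½ p → ρ p ∈ J½-residues
  to J½p with J½⇒representative J½p
  ... | d , k , d∈ , refl = subst (_∈ J½-residues) (sym (ρ-periodic d k)) (∈-map⁺ ρ d∈)
  from : ρ p ∈ J½-residues → J½ p
  from ρp∈ with ∈-map⁻ ρ ρp∈
  ... | d , d∈ , ρp≡ρd = subst J½ (sym (same-ρ p d ρp≡ρd)) (representative⇒J½ _ d∈)

-- I-stability

module _ {S S′ : Point → Set} where

  ExactlyThreeIn-map : (f : Point → Point) → (∀ x → S x ⇔ S′ (f x)) →
    ∀ {a b c p} → ExactlyThreeIn S a b c p → ExactlyThreeIn S′ (f a) (f b) (f c) (f p)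
  ExactlyThreeIn-map f S⇔S′ = map-cases
    where
    to : ∀ {x} → S x → S′ (f x)
    to {x} = Equivalence.to (S⇔S′ x)
    not : ∀ {x} → ¬ S x → ¬ S′ (f x)
    not {x} ¬Sx = ¬Sx ∘ Equivalence.from (S⇔S′ x)
    map-cases : ∀ {a b c p} → ExactlyThreeIn S a b c p → ExactlyThreeIn S′ (f a) (f b) (f c) (f p)
    map-cases (inj₁ (na , sb , sc , sp))                = inj₁ (not na , to sb , to sc , to sp)
    map-cases (inj₂ (inj₁ (sa , nb , sc , sp)))         = inj₂ (inj₁ (to sa , not nb , to sc , to sp))
    map-cases (inj₂ (inj₂ (inj₁ (sa , sb , nc , sp))))  = inj₂ (inj₂ (inj₁ (to sa , to sb , not nc , to sp)))
    map-cases (inj₂ (inj₂ (inj₂ (sa , sb , sc , np))))  = inj₂ (inj₂ (inj₂ (to sa , to sb , to sc , not np)))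

ExactlyThreeIn? : ∀ {S : Point → Set} → Decidable S → ∀ a b c p → Dec (ExactlyThreeIn S a b c p)
ExactlyThreeIn? S? a b c p =
        (¬? (S? a) ×-dec S? b ×-dec S? c ×-dec S? p)
  ⊎-dec (S? a ×-dec ¬? (S? b) ×-dec S? c ×-dec S? p)
  ⊎-dec (S? a ×-dec S? b ×-dec ¬? (S? c) ×-dec S? p)
  ⊎-dec (S? a ×-dec S? b ×-dec S? c ×-dec ¬? (S? p))

ExactlyThreeIn-swap : ∀ {S : Point → Set} {a b c p} → ExactlyThreeIn S a b c p → ExactlyThreeIn S a c b p
ExactlyThreeIn-swap (inj₁ (na , sb , sc , sp))                = inj₁ (na , sc , sb , sp)
ExactlyThreeIn-swap (inj₂ (inj₁ (sa , nb , sc , sp)))         = inj₂ (inj₂ (inj₁ (sa , sc , nb , sp)))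
ExactlyThreeIn-swap (inj₂ (inj₂ (inj₁ (sa , sb , nc , sp))))  = inj₂ (inj₁ (sa , nc , sb , sp))
ExactlyThreeIn-swap (inj₂ (inj₂ (inj₂ (sa , sb , sc , np))))  = inj₂ (inj₂ (inj₂ (sa , sc , sb , np)))

digits : List ℤ
digits = map +_ (upTo 4)

residue∈digits : ∀ x → residue x ∈ digits
residue∈digits x = ∈-map⁺ +_ (∈-upTo⁺ (n%ℕd<d x 4))

residues : List Point
residues = cartesianProduct digits digits

ρ∈residues : ∀ p → ρ p ∈ residues
ρ∈residues (x , y) = ∈-cartesianProduct⁺ (residue∈digits x) (residue∈digits y)

_∈?J½-residues : Decidable (_∈ J½-residues)
p ∈?J½-residues = Membership.any? (≡-dec ℤ._≟_ ℤ._≟_ p) J½-residues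

ResidueCheck : Point → Point → Point → Set
ResidueCheck ra rb rp =
  Even (ra -ᵥ rp) ⊎ Even (rb -ᵥ rp) ⊎ Even (rc -ᵥ rp) ⊎ ¬ ExactlyThreeIn (_∈ J½-residues) ra rb rc rp
  where
  rc : Point
  rc = third-residue ra rb rp

residue-check : All (λ ra → All (λ rb → All (ResidueCheck ra rb) residues) residues) residues
residue-check = Dec.toWitness {a? = all? (λ ra → all? (λ rb → all? (check ra rb) residues) residues) residues} _
  where
  check : ∀ ra rb rp → Dec (ResidueCheck ra rb rp)
  check ra rb rp =
          Even? (ra -ᵥ rp) ⊎-dec Even? (rb -ᵥ rp) ⊎-dec Even? (rc -ᵥ rp)
    ⊎-dec ¬? (ExactlyThreeIn? _∈?J½-residues ra rb rc rp)
    where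
    rc : Point
    rc = third-residue ra rb rp

EmptyAroundOrigin⇒¬ExactlyThreeIn-J½ : ∀ a b c p → EmptyAroundOrigin (a -ᵥ p) (b -ᵥ p) (c -ᵥ p) →
  ¬ ExactlyThreeIn J½ a b c p
EmptyAroundOrigin⇒¬ExactlyThreeIn-J½ a b c p E three = excluded
  (All.lookup (All.lookup (All.lookup residue-check (ρ∈residues a)) (ρ∈residues b)) (ρ∈residues p))
  where
  ρ-third≡ρc : third-residue (ρ a) (ρ b) (ρ p) ≡ ρ c
  ρ-third≡ρc = sym (ρ-of-third a b c p (centroid E))
  excluded : ResidueCheck (ρ a) (ρ b) (ρ p) → ⊥
  excluded (inj₁ ev) = not-even E (even-from-residues a p ev)
  excluded (inj₂ (inj₁ ev)) = not-even (rotate E) (even-from-residues b p ev)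
  excluded (inj₂ (inj₂ (inj₁ ev))) =
    not-even (rotate (rotate E)) (even-from-residues c p (subst (λ r → Even (r -ᵥ ρ p)) ρ-third≡ρc ev))
  excluded (inj₂ (inj₂ (inj₂ ¬three))) =
    ¬three (subst (λ r → ExactlyThreeIn (_∈ J½-residues) (ρ a) (ρ b) r (ρ p)) (sym ρ-third≡ρc)
                  (ExactlyThreeIn-map {J½} {_∈ J½-residues} ρ J½⇔residue three))

InternalTriangle-swap : ∀ a b c p → InternalTriangle a b c p → InternalTriangle a c b p
InternalTriangle-swap a b c p (noncollinear , interior , hull) =
  noncollinear ∘ flat , InInterior-swap a b c p interior ,
  λ q h → swap-OneOf (hull q (InHull-swap a c b q h))
  where
  flat : area a c b ≡ 0ℤ → area a b c ≡ 0ℤ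
  flat e = ℤ.neg-injective (trans (sym (area-swap a b c)) e)
  swap-OneOf : ∀ {q} → OneOf q a b c p → OneOf q a c b p
  swap-OneOf (inj₁ e)                = inj₁ e
  swap-OneOf (inj₂ (inj₁ e))         = inj₂ (inj₂ (inj₁ e))
  swap-OneOf (inj₂ (inj₂ (inj₁ e)))  = inj₂ (inj₁ e)
  swap-OneOf (inj₂ (inj₂ (inj₂ e)))  = inj₂ (inj₂ (inj₂ e))

J½-stable-positively-oriented : ∀ a b c p → InternalTriangle a b c p → 0ℤ < area a b c → ¬ ExactlyThreeIn J½ a b c p
J½-stable-positively-oriented a b c p T 0<D =
  EmptyAroundOrigin⇒¬ExactlyThreeIn-J½ a b c p (internal⇒EmptyAroundOrigin a b c p T 0<D)

J½-IStable : IStable J½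
J½-IStable a b c p T@(noncollinear , _ , _) with ℤ.<-cmp 0ℤ (area a b c)
... | tri< 0<D _ _ = J½-stable-positively-oriented a b c p T 0<D
... | tri≈ _ 0≡D _ = ⊥-elim (noncollinear (sym 0≡D))
... | tri> _ _ D<0 = J½-stable-positively-oriented a c b p (InternalTriangle-swap a b c p T)
                       (subst (0ℤ <_) (sym (area-swap a b c)) (ℤ.neg-mono-< D<0)) ∘ ExactlyThreeIn-swap {J½}

-- Counting points of J½ in boxes

module _ {A : Set} where

  Unique⇒length-≤ : ∀ {xs ys : List A} → Unique xs → (∀ {z} → z ∈ xs → z ∈ ys) → length xs ℕ.≤ length ys
  Unique⇒length-≤ {[]}     _               _  = ℕ.z≤n
  Unique⇒length-≤ {x ∷ xs} (x∉xs ∷ unique) xs⊆ys with ∈-∃++ (xs⊆ys (here refl))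
  ... | us , vs , refl = begin
    suc (length xs)          ≤⟨ ℕ.s≤s (Unique⇒length-≤ unique xs⊆us++vs) ⟩
    suc (length (us ++ vs))  ≡⟨ cong suc (length-++ us) ⟩
    suc (length us ℕ.+ length vs) ≡⟨ ℕ.+-suc (length us) (length vs) ⟨
    length us ℕ.+ suc (length vs) ≡⟨ length-++ us ⟨
    length (us ++ x ∷ vs)    ∎
    where
    open ℕ.≤-Reasoning
    xs⊆us++vs : ∀ {z} → z ∈ xs → z ∈ us ++ vs
    xs⊆us++vs z∈xs with ∈-++⁻ us (xs⊆ys (there z∈xs))
    ... | inj₁ z∈us          = ∈-++⁺ˡ z∈us
    ... | inj₂ (here refl)   = ⊥-elim (All.lookup x∉xs z∈xs refl)
    ... | inj₂ (there z∈vs)  = ∈-++⁺ʳ us z∈vs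

  module _ {P : A → Set} (P? : Decidable P) where

    count : List A → ℕ
    count xs = length (filter P? xs)

    count-++ : ∀ xs ys → count (xs ++ ys) ≡ count xs ℕ.+ count ys
    count-++ xs ys = trans (cong length (filter-++ P? xs ys)) (length-++ (filter P? xs))

module _ {A B : Set} {P : A → Set} {Q : B → Set} (P? : Decidable P) (Q? : Decidable Q) where

  count-cong : ∀ (f : ℕ → A) (g : ℕ → B) → (∀ i → P (f i) ⇔ Q (g i)) →
               ∀ m → count P? (applyUpTo f m) ≡ count Q? (applyUpTo g m)
  count-cong f g P⇔Q zero = refl
  count-cong f g P⇔Q (suc m) with P? (f 0) | Q? (g 0)
  ... | yes _   | yes _   = cong suc (count-cong (f ∘ suc) (g ∘ suc) (P⇔Q ∘ suc) m)
  ... | no _    | no _    = count-cong (f ∘ suc) (g ∘ suc) (P⇔Q ∘ suc) m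
  ... | yes Pf₀ | no ¬Qg₀ = ⊥-elim (¬Qg₀ (Equivalence.to (P⇔Q 0) Pf₀))
  ... | no ¬Pf₀ | yes Qg₀ = ⊥-elim (¬Pf₀ (Equivalence.from (P⇔Q 0) Qg₀))

module _ {A : Set} {P : A → Set} (P? : Decidable P) where

  count-periodic : ∀ (f : ℕ → A) → (∀ i → count P? (applyUpTo (λ j → f (i ℕ.+ j)) 4) ≡ 2) →
    ∀ q t → (2 ℕ.* q ℕ.≤ count P? (applyUpTo f (q ℕ.* 4 ℕ.+ t)))
          × (count P? (applyUpTo f (q ℕ.* 4 ℕ.+ t)) ℕ.≤ 2 ℕ.* q ℕ.+ t)
  count-periodic f _ zero t =
    ℕ.z≤n , ℕ.≤-trans (length-filter P? (applyUpTo f t)) (ℕ.≤-reflexive (length-applyUpTo f t))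
  count-periodic f two-per-block (suc q) t =
    (begin
      2 ℕ.* suc q                ≡⟨ ℕ.*-suc 2 q ⟩
      2 ℕ.+ 2 ℕ.* q              ≤⟨ ℕ.+-monoʳ-≤ 2 (proj₁ bounds) ⟩
      2 ℕ.+ count P? rest        ≡⟨ split ⟨
      count P? (applyUpTo f (suc q ℕ.* 4 ℕ.+ t)) ∎) ,
    (begin
      count P? (applyUpTo f (suc q ℕ.* 4 ℕ.+ t)) ≡⟨ split ⟩
      2 ℕ.+ count P? rest        ≤⟨ ℕ.+-monoʳ-≤ 2 (proj₂ bounds) ⟩
      2 ℕ.+ (2 ℕ.* q ℕ.+ t)      ≡⟨ ℕ.+-assoc 2 (2 ℕ.* q) t ⟨
      2 ℕ.+ 2 ℕ.* q ℕ.+ t        ≡⟨ cong (ℕ._+ t) (ℕ.*-suc 2 q) ⟨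
      2 ℕ.* suc q ℕ.+ t          ∎)
    where
    open ℕ.≤-Reasoning
    rest : List A
    rest = applyUpTo (λ j → f (4 ℕ.+ j)) (q ℕ.* 4 ℕ.+ t)
    split : count P? (applyUpTo f (suc q ℕ.* 4 ℕ.+ t)) ≡ 2 ℕ.+ count P? rest
    split = trans (count-++ P? (applyUpTo f 4) rest) (cong (ℕ._+ count P? rest) (two-per-block 0))
    bounds : (2 ℕ.* q ℕ.≤ count P? rest) × (count P? rest ℕ.≤ 2 ℕ.* q ℕ.+ t)
    bounds = count-periodic (λ j → f (4 ℕ.+ j)) (λ i → two-per-block (4 ℕ.+ i)) q t

module _ {A B : Set} {P : A × B → Set} (P? : Decidable P) where

  count-product : ∀ {lo hi} (xs : List A) (ys : List B) →
    (∀ x → (lo ℕ.≤ count P? (map (x ,_) ys)) × (count P? (map (x ,_) ys) ℕ.≤ hi)) →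
    (length xs ℕ.* lo ℕ.≤ count P? (cartesianProduct xs ys))
    × (count P? (cartesianProduct xs ys) ℕ.≤ length xs ℕ.* hi)
  count-product []       ys row-bounds = ℕ.z≤n , ℕ.z≤n
  count-product {lo} {hi} (x ∷ xs) ys row-bounds =
    subst (lo ℕ.+ length xs ℕ.* lo ℕ.≤_) (sym split) (ℕ.+-mono-≤ (proj₁ (row-bounds x)) (proj₁ rest)) ,
    subst (ℕ._≤ hi ℕ.+ length xs ℕ.* hi) (sym split) (ℕ.+-mono-≤ (proj₂ (row-bounds x)) (proj₂ rest))
    where
    split : count P? (cartesianProduct (x ∷ xs) ys)
            ≡ count P? (map (x ,_) ys) ℕ.+ count P? (cartesianProduct xs ys)
    split = count-++ P? (map (x ,_) ys) (cartesianProduct xs ys)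
    rest : (length xs ℕ.* lo ℕ.≤ count P? (cartesianProduct xs ys))
         × (count P? (cartesianProduct xs ys) ℕ.≤ length xs ℕ.* hi)
    rest = count-product xs ys row-bounds

interval : ℤ → ℕ → List ℤ
interval s m = applyUpTo (λ i → s + + i) m

interval-unique : ∀ s m → Unique (interval s m)
interval-unique s m = Unique.applyUpTo⁺₁ (λ i → s + + i) m
  (λ i<j _ eq → ℕ.<⇒≢ i<j (ℤ.+-injective (+-cancelˡ s eq)))

∈-interval⁻ : ∀ {s m x} → x ∈ interval s m → (s ≤ x) × (x < s + + m)
∈-interval⁻ {s} {m} x∈ with ∈-applyUpTo⁻ (λ i → s + + i) x∈
... | i , i<m , refl = ℤ.i≤i+j s (+ i) , ℤ.+-monoʳ-< s (+<+ i<m)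

∈-interval⁺ : ∀ {s m x} → s ≤ x → x < s + + m → x ∈ interval s m
∈-interval⁺ {s} {m} {x} s≤x x<s+m =
  subst (_∈ interval s m) s+[x-s]≡x (∈-applyUpTo⁺ (λ i → s + + i) (ℤ.drop‿+<+ ∣x-s∣<m))
  where
  open ≡-Reasoning
  0≤x-s : 0ℤ ≤ x - s
  0≤x-s = ℤ.i≤j⇒0≤j-i s≤x
  s+[x-s]≡x : s + + ℤ.∣ x - s ∣ ≡ x
  s+[x-s]≡x = begin
    s + + ℤ.∣ x - s ∣ ≡⟨ cong (_+_ s) (ℤ.0≤i⇒+∣i∣≡i 0≤x-s) ⟩
    s + (x - s)       ≡⟨ solve (s ∷ x ∷ []) ⟩
    x                 ∎
  x-s<m : x - s < + m
  x-s<m = subst (x - s <_) (x+y-x≡y s (+ m)) (ℤ.+-monoˡ-< (- s) x<s+m)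
  ∣x-s∣<m : + ℤ.∣ x - s ∣ < + m
  ∣x-s∣<m = subst (_< + m) (sym (ℤ.0≤i⇒+∣i∣≡i 0≤x-s)) x-s<m

J½? : Decidable J½
J½? p = Dec.map′ (Equivalence.from (J½⇔residue p)) (Equivalence.to (J½⇔residue p)) (ρ p ∈?J½-residues)

residue-shift : ∀ y j → residue (y + + j) ≡ residue (residue y + + j)
residue-shift y j = begin
  residue (y + + j)                                ≡⟨ cong (λ t → residue (t + + j)) (decompose y) ⟩
  residue (residue y + + 4 * (y /ℕ 4) + + j)       ≡⟨ cong residue (ℤ+.xy∙z≈xz∙y (residue y) (+ 4 * (y /ℕ 4)) (+ j)) ⟩
  residue (residue y + + j + + 4 * (y /ℕ 4))       ≡⟨ residue-periodic (residue y + + j) (y /ℕ 4) ⟩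
  residue (residue y + + j)                        ∎
  where open ≡-Reasoning

window-residues : All (λ r → All (λ s →
  count _∈?J½-residues (applyUpTo (λ j → (r , residue (s + + j))) 4) ≡ 2) digits) digits
window-residues = Dec.toWitness {a? = all? (λ r → all? (λ s →
  count _∈?J½-residues (applyUpTo (λ j → (r , residue (s + + j))) 4) ℕ.≟ 2) digits) digits} _

J½-window : ∀ x y → count J½? (applyUpTo (λ j → (x , y + + j)) 4) ≡ 2
J½-window x y = trans (count-cong J½? _∈?J½-residues (λ j → (x , y + + j))
                                  (λ j → (residue x , residue (residue y + + j))) via-residues 4)
                      (All.lookup (All.lookup window-residues (residue∈digits x)) (residue∈digits y))
  where
  via-residues : ∀ j → J½ (x , y + + j) ⇔ ((residue x , residue (residue y + + j)) ∈ J½-residues)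
  via-residues j = subst (λ r → J½ (x , y + + j) ⇔ ((residue x , r) ∈ J½-residues))
                         (residue-shift y j) (J½⇔residue (x , y + + j))

J½-row : ∀ x s q t → (2 ℕ.* q ℕ.≤ count J½? (map (x ,_) (interval s (q ℕ.* 4 ℕ.+ t))))
                   × (count J½? (map (x ,_) (interval s (q ℕ.* 4 ℕ.+ t))) ℕ.≤ 2 ℕ.* q ℕ.+ t)
J½-row x s q t = subst (λ row → (2 ℕ.* q ℕ.≤ count J½? row) × (count J½? row ℕ.≤ 2 ℕ.* q ℕ.+ t))
                       (sym (map-applyUpTo (λ i → s + + i) (x ,_) (q ℕ.* 4 ℕ.+ t)))
                       (count-periodic J½? (λ i → (x , s + + i)) two-per-block q t)
  where
  shift : ∀ i j → s + + (i ℕ.+ j) ≡ s + + i + + j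
  shift i j = trans (cong (_+_ s) (ℤ.pos-+ i j)) (sym (ℤ.+-assoc s (+ i) (+ j)))
  two-per-block : ∀ i → count J½? (applyUpTo (λ j → (x , s + + (i ℕ.+ j))) 4) ≡ 2
  two-per-block i = trans (count-cong J½? J½? (λ j → (x , s + + (i ℕ.+ j))) (λ j → (x , s + + i + + j))
                             (λ j → subst (λ y → J½ (x , s + + (i ℕ.+ j)) ⇔ J½ (x , y)) (shift i j) (⇔-id _)) 4)
                          (J½-window x (s + + i))

width : ℕ → ℕ
width n = suc (2 ℕ.* n)

side : ℕ → List ℤ
side n = interval (- + n) (width n)

box : ℕ → List Point
box n = cartesianProduct (side n) (side n)

side-end : ∀ n → - + n + + width n ≡ + suc n
side-end n = begin
  - + n + + width n             ≡⟨ cong (λ t → - + n + (1ℤ + t)) (ℤ.pos-* 2 n) ⟩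
  - + n + (1ℤ + + 2 * + n)      ≡⟨ ring (+ n) ⟩
  1ℤ + + n                      ∎
  where
  open ≡-Reasoning
  ring : ∀ m → - m + (1ℤ + + 2 * m) ≡ 1ℤ + m
  ring = solve-∀

∈-side : ∀ n x → x ∈ side n ⇔ ((- + n ≤ x) × (x ≤ + n))
∈-side n x = mk⇔ to from
  where
  to : x ∈ side n → (- + n ≤ x) × (x ≤ + n)
  to x∈ with ∈-interval⁻ x∈
  ... | -n≤x , x<end = -n≤x , ℤ.i<j⇒i≤pred[j] (subst (x <_) (side-end n) x<end)
  from : (- + n ≤ x) × (x ≤ + n) → x ∈ side n
  from (-n≤x , x≤n) = ∈-interval⁺ -n≤x (subst (x <_) (sym (side-end n)) (ℤ.i≤pred[j]⇒i<j x≤n))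

J½-in-box : ℕ → List Point
J½-in-box n = filter J½? (box n)

∈-box⇔InBox : ∀ n p → p ∈ box n ⇔ InBox n p
∈-box⇔InBox n (x , y) = mk⇔ to from
  where
  to : (x , y) ∈ box n → InBox n (x , y)
  to p∈ = let x∈ , y∈ = ∈-cartesianProduct⁻ (side n) (side n) p∈
              -n≤x , x≤n = Equivalence.to (∈-side n x) x∈
              -n≤y , y≤n = Equivalence.to (∈-side n y) y∈
          in -n≤x , x≤n , -n≤y , y≤n
  from : InBox n (x , y) → (x , y) ∈ box n
  from (-n≤x , x≤n , -n≤y , y≤n) = ∈-cartesianProduct⁺ {xs = side n} {ys = side n}
    (Equivalence.from (∈-side n x) (-n≤x , x≤n)) (Equivalence.from (∈-side n y) (-n≤y , y≤n))

J½-in-box-BoxCount : ∀ n → BoxCount J½ n (length (J½-in-box n))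
J½-in-box-BoxCount n = J½-in-box n , unique , members , refl
  where
  side-unique : Unique (side n)
  side-unique = interval-unique (- + n) (width n)
  unique : Unique (J½-in-box n)
  unique = Unique.filter⁺ J½? {box n} (Unique.cartesianProduct⁺ {xs = side n} {ys = side n} side-unique side-unique)
  members : ∀ p → p ∈ J½-in-box n ⇔ (InBox n p × J½ p)
  members p = mk⇔
    (λ p∈ → let p∈box , J½p = ∈-filter⁻ J½? {v = p} {xs = box n} p∈ in Equivalence.to (∈-box⇔InBox n p) p∈box , J½p)
    (λ (inBox , J½p) → ∈-filter⁺ J½? {x = p} {xs = box n} (Equivalence.from (∈-box⇔InBox n p) inBox) J½p)

BoxCount-unique : ∀ {X n k k′} → BoxCount X n k → BoxCount X n k′ → k ≡ k′
BoxCount-unique (L , uL , L⇔ , refl) (L′ , uL′ , L′⇔ , refl) =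
  ℕ.≤-antisym (Unique⇒length-≤ uL (λ {z} z∈ → Equivalence.from (L′⇔ z) (Equivalence.to (L⇔ z) z∈)))
              (Unique⇒length-≤ uL′ (λ {z} z∈ → Equivalence.from (L⇔ z) (Equivalence.to (L′⇔ z) z∈)))

periodic-count-estimate : ∀ {N q t k} → N ≡ q ℕ.* 4 ℕ.+ t → t ℕ.≤ 3 →
  N ℕ.* (2 ℕ.* q) ℕ.≤ k → k ℕ.≤ N ℕ.* (2 ℕ.* q ℕ.+ t) →
  (2 ℕ.* k ℕ.≤ N ℕ.* N ℕ.+ 3 ℕ.* N) × (N ℕ.* N ℕ.≤ 2 ℕ.* k ℕ.+ 3 ℕ.* N)
periodic-count-estimate {N} {q} {t} {k} refl t≤3 lower upper =
  (begin
    2 ℕ.* k                             ≤⟨ ℕ.*-monoʳ-≤ 2 upper ⟩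
    2 ℕ.* (N ℕ.* (2 ℕ.* q ℕ.+ t))       ≡⟨ solveℕ (q ∷ t ∷ []) ⟩
    N ℕ.* N ℕ.+ t ℕ.* N                 ≤⟨ ℕ.+-monoʳ-≤ (N ℕ.* N) (ℕ.*-monoˡ-≤ N t≤3) ⟩
    N ℕ.* N ℕ.+ 3 ℕ.* N                 ∎) ,
  (begin
    N ℕ.* N                             ≡⟨ solveℕ (q ∷ t ∷ []) ⟩
    2 ℕ.* (N ℕ.* (2 ℕ.* q)) ℕ.+ t ℕ.* N ≤⟨ ℕ.+-mono-≤ (ℕ.*-monoʳ-≤ 2 lower) (ℕ.*-monoˡ-≤ N t≤3) ⟩
    2 ℕ.* k ℕ.+ 3 ℕ.* N                 ∎)
  where open ℕ.≤-Reasoning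

J½-box-estimate : ∀ n →
  (2 ℕ.* length (J½-in-box n) ℕ.≤ width n ℕ.* width n ℕ.+ 3 ℕ.* width n)
  × (width n ℕ.* width n ℕ.≤ 2 ℕ.* length (J½-in-box n) ℕ.+ 3 ℕ.* width n)
J½-box-estimate n = periodic-count-estimate {width n} {q} {t} {length (J½-in-box n)} width≡ t≤3
  (subst (ℕ._≤ length (J½-in-box n)) (cong (ℕ._* (2 ℕ.* q)) length-side) (proj₁ bounds))
  (subst (length (J½-in-box n) ℕ.≤_) (cong (ℕ._* (2 ℕ.* q ℕ.+ t)) length-side) (proj₂ bounds))
  where
  q t : ℕ
  q = width n ℕ./ 4
  t = width n ℕ.% 4
  width≡ : width n ≡ q ℕ.* 4 ℕ.+ t
  width≡ = trans (m≡m%n+[m/n]*n (width n) 4) (ℕ.+-comm t (q ℕ.* 4))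
  t≤3 : t ℕ.≤ 3
  t≤3 = ℕ.≤-pred (m%n<n (width n) 4)
  length-side : length (side n) ≡ width n
  length-side = length-applyUpTo (λ i → - + n + + i) (width n)
  rows : ∀ x → (2 ℕ.* q ℕ.≤ count J½? (map (x ,_) (side n)))
             × (count J½? (map (x ,_) (side n)) ℕ.≤ 2 ℕ.* q ℕ.+ t)
  rows x = subst (λ m → (2 ℕ.* q ℕ.≤ count J½? (map (x ,_) (interval (- + n) m)))
                      × (count J½? (map (x ,_) (interval (- + n) m)) ℕ.≤ 2 ℕ.* q ℕ.+ t))
                 (sym width≡) (J½-row x (- + n) q t)
  bounds : (length (side n) ℕ.* (2 ℕ.* q) ℕ.≤ count J½? (box n))
         × (count J½? (box n) ℕ.≤ length (side n) ℕ.* (2 ℕ.* q ℕ.+ t))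
  bounds = count-product J½? (side n) (side n) rows

½ : ℚ
½ = + 1 / 2

-- mkℚᵘ takes the denominator minus one: 2n + 2n · width n = width n² − 1.
ratio<½+ : ∀ k n a b .(c : Coprimality.Coprime (suc a) (suc b)) →
  k ℕ.* (2 ℕ.* suc b) ℕ.< (suc b ℕ.+ suc a ℕ.* 2) ℕ.* (width n ℕ.* width n) →
  ratio k n ℚ.< ½ ℚ.+ mkℚ ℤ.+[1+ a ] b c
ratio<½+ k n a b c k<ᵘ = ℚ.toℚᵘ-cancel-<
  (ℚᵘ.<-respˡ-≃ (ℚᵘ.≃-sym (ℚ.toℚᵘ-fromℚᵘ (ℚᵘ.mkℚᵘ (+ k) (2 ℕ.* n ℕ.+ 2 ℕ.* n ℕ.* width n))))
  (ℚᵘ.<-respʳ-≃ (ℚᵘ.≃-sym (ℚ.toℚᵘ-homo-+ ½ (mkℚ ℤ.+[1+ a ] b c)))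
  (ℚᵘ.*<* (subst₂ _<_ (ℤ.pos-* k (2 ℕ.* suc b)) (sym numerator) (+<+ k<ᵘ)))))
  where
  open ≡-Reasoning
  X : ℕ
  X = width n ℕ.* width n
  numerator : (+ 1 * + suc b + + suc a * + 2) * + X ≡ + ((suc b ℕ.+ suc a ℕ.* 2) ℕ.* X)
  numerator = begin
    (+ 1 * + suc b + + suc a * + 2) * + X  ≡⟨ cong (λ t → (t + + suc a * + 2) * + X) (ℤ.*-identityˡ (+ suc b)) ⟩
    (+ suc b + + suc a * + 2) * + X        ≡⟨ cong (λ t → (+ suc b + t) * + X) (ℤ.pos-* (suc a) 2) ⟨
    (+ suc b + + (suc a ℕ.* 2)) * + X      ≡⟨ cong (_* + X) (ℤ.pos-+ (suc b) (suc a ℕ.* 2)) ⟨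
    + (suc b ℕ.+ suc a ℕ.* 2) * + X        ≡⟨ ℤ.pos-* (suc b ℕ.+ suc a ℕ.* 2) X ⟨
    + ((suc b ℕ.+ suc a ℕ.* 2) ℕ.* X)      ∎

½-<ratio : ∀ k n a b .(c : Coprimality.Coprime (suc a) (suc b)) →
  suc b ℕ.* (width n ℕ.* width n) ℕ.< k ℕ.* (2 ℕ.* suc b) ℕ.+ suc a ℕ.* 2 ℕ.* (width n ℕ.* width n) →
  ½ ℚ.- mkℚ ℤ.+[1+ a ] b c ℚ.< ratio k n
½-<ratio k n a b c <ᵘk = ℚ.toℚᵘ-cancel-<
  (ℚᵘ.<-respʳ-≃ (ℚᵘ.≃-sym (ℚ.toℚᵘ-fromℚᵘ (ℚᵘ.mkℚᵘ (+ k) (2 ℕ.* n ℕ.+ 2 ℕ.* n ℕ.* width n))))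
  (ℚᵘ.<-respˡ-≃ (ℚᵘ.≃-sym (ℚ.toℚᵘ-homo-+ ½ (mkℚ ℤ.-[1+ a ] b c)))
  (ℚᵘ.*<* (subst₂ _<_ (sym numerator) (ℤ.pos-* k (2 ℕ.* suc b)) shifted))))
  where
  open ≡-Reasoning
  X A : ℕ
  X = width n ℕ.* width n
  A = suc a ℕ.* 2 ℕ.* X
  numerator : (+ 1 * + suc b + ℤ.-[1+ a ] * + 2) * + X ≡ + (suc b ℕ.* X) - + A
  numerator = begin
    (+ 1 * + suc b + ℤ.-[1+ a ] * + 2) * + X  ≡⟨ expand (+ suc b) (+ suc a) (+ X) ⟩
    + suc b * + X - + suc a * + 2 * + X      ≡⟨ cong₂ (λ s t → s - t * + X) (ℤ.pos-* (suc b) X) (ℤ.pos-* (suc a) 2) ⟨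
    + (suc b ℕ.* X) - + (suc a ℕ.* 2) * + X  ≡⟨ cong (λ t → + (suc b ℕ.* X) - t) (ℤ.pos-* (suc a ℕ.* 2) X) ⟨
    + (suc b ℕ.* X) - + A                    ∎
    where
    expand : ∀ B A X → (+ 1 * B + (- A) * + 2) * X ≡ B * X - A * + 2 * X
    expand = solve-∀
  shifted : + (suc b ℕ.* X) - + A < + (k ℕ.* (2 ℕ.* suc b))
  shifted = subst (+ (suc b ℕ.* X) - + A <_) (x+y-y≡x (+ (k ℕ.* (2 ℕ.* suc b))) (+ A))
    (ℤ.+-monoˡ-< (- + A) (subst (+ (suc b ℕ.* X) <_) (ℤ.pos-+ (k ℕ.* (2 ℕ.* suc b)) A) (+<+ <ᵘk)))

ratio-excess-bound : ∀ k W B A → 3 ℕ.* B ℕ.< W → 2 ℕ.* k ℕ.≤ W ℕ.* W ℕ.+ 3 ℕ.* W →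
               k ℕ.* (2 ℕ.* B) ℕ.< (B ℕ.+ suc A ℕ.* 2) ℕ.* (W ℕ.* W)
ratio-excess-bound k W B A 3B<W 2k≤ = begin-strict
  k ℕ.* (2 ℕ.* B)                              ≡⟨ solveℕ (k ∷ B ∷ []) ⟩
  B ℕ.* (2 ℕ.* k)                              ≤⟨ ℕ.*-monoʳ-≤ B 2k≤ ⟩
  B ℕ.* (W ℕ.* W ℕ.+ 3 ℕ.* W)                  ≡⟨ solveℕ (B ∷ W ∷ []) ⟩
  B ℕ.* (W ℕ.* W) ℕ.+ 3 ℕ.* B ℕ.* W            <⟨ ℕ.+-monoʳ-< (B ℕ.* (W ℕ.* W)) (ℕ.*-monoˡ-< W {{W≢0}} 3B<W) ⟩
  B ℕ.* (W ℕ.* W) ℕ.+ W ℕ.* W                  ≤⟨ ℕ.+-monoʳ-≤ (B ℕ.* (W ℕ.* W)) (ℕ.m≤n*m (W ℕ.* W) (suc A ℕ.* 2)) ⟩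
  B ℕ.* (W ℕ.* W) ℕ.+ suc A ℕ.* 2 ℕ.* (W ℕ.* W) ≡⟨ solveℕ (B ∷ A ∷ W ∷ []) ⟩
  (B ℕ.+ suc A ℕ.* 2) ℕ.* (W ℕ.* W)            ∎
  where
  open ℕ.≤-Reasoning
  W≢0 : ℕ.NonZero W
  W≢0 = ℕ.>-nonZero (ℕ.≤-<-trans ℕ.z≤n 3B<W)

ratio-deficit-bound : ∀ k W B A → 3 ℕ.* B ℕ.< W → W ℕ.* W ℕ.≤ 2 ℕ.* k ℕ.+ 3 ℕ.* W →
                B ℕ.* (W ℕ.* W) ℕ.< k ℕ.* (2 ℕ.* B) ℕ.+ suc A ℕ.* 2 ℕ.* (W ℕ.* W)
ratio-deficit-bound k W B A 3B<W W²≤ = begin-strict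
  B ℕ.* (W ℕ.* W)                              ≤⟨ ℕ.*-monoʳ-≤ B W²≤ ⟩
  B ℕ.* (2 ℕ.* k ℕ.+ 3 ℕ.* W)                  ≡⟨ solveℕ (B ∷ k ∷ W ∷ []) ⟩
  k ℕ.* (2 ℕ.* B) ℕ.+ 3 ℕ.* B ℕ.* W            <⟨ ℕ.+-monoʳ-< (k ℕ.* (2 ℕ.* B)) (ℕ.*-monoˡ-< W {{W≢0}} 3B<W) ⟩
  k ℕ.* (2 ℕ.* B) ℕ.+ W ℕ.* W                  ≤⟨ ℕ.+-monoʳ-≤ (k ℕ.* (2 ℕ.* B)) (ℕ.m≤n*m (W ℕ.* W) (suc A ℕ.* 2)) ⟩
  k ℕ.* (2 ℕ.* B) ℕ.+ suc A ℕ.* 2 ℕ.* (W ℕ.* W) ∎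
  where
  open ℕ.≤-Reasoning
  W≢0 : ℕ.NonZero W
  W≢0 = ℕ.>-nonZero (ℕ.≤-<-trans ℕ.z≤n 3B<W)

width-large : ∀ b n → n ℕ.≥ 3 ℕ.* suc b → 3 ℕ.* suc b ℕ.< width n
width-large b n n≥ = ℕ.s≤s (ℕ.≤-trans n≥ (ℕ.m≤m+n n (n ℕ.+ 0)))

J½-upper-density : UpperDensityEq J½ ½
J½-upper-density = eventually-below , infinitely-often-above
  where
  eventually-below : ∀ ε → 0ℚ ℚ.< ε → ∃[ N ] ∀ n k → n ℕ.≥ N → BoxCount J½ n k → ratio k n ℚ.< ½ ℚ.+ ε
  eventually-below (mkℚ ℤ.+[1+ a ] b c) _ = 3 ℕ.* suc b , λ n k n≥ box-count →
    subst (λ k → ratio k n ℚ.< ½ ℚ.+ mkℚ ℤ.+[1+ a ] b c)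
          (BoxCount-unique (J½-in-box-BoxCount n) box-count)
          (ratio<½+ (length (J½-in-box n)) n a b c
            (ratio-excess-bound (length (J½-in-box n)) (width n) (suc b) a (width-large b n n≥) (proj₁ (J½-box-estimate n))))
  eventually-below (mkℚ (+ 0) _ _) (ℚ.*<* (+<+ ()))
  eventually-below (mkℚ ℤ.-[1+ _ ] _ _) (ℚ.*<* ())
  infinitely-often-above : ∀ ε → 0ℚ ℚ.< ε → ∀ N →
    ∃[ n ] ∃[ k ] (n ℕ.≥ N) × BoxCount J½ n k × (½ ℚ.- ε ℚ.< ratio k n)
  infinitely-often-above (mkℚ ℤ.+[1+ a ] b c) _ N =
    n , length (J½-in-box n) , ℕ.m≤m+n N (3 ℕ.* suc b) , J½-in-box-BoxCount n ,
    ½-<ratio (length (J½-in-box n)) n a b c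
      (ratio-deficit-bound (length (J½-in-box n)) (width n) (suc b) a
        (width-large b n (ℕ.m≤n+m (3 ℕ.* suc b) N)) (proj₂ (J½-box-estimate n)))
    where
    n : ℕ
    n = N ℕ.+ 3 ℕ.* suc b
  infinitely-often-above (mkℚ (+ 0) _ _) (ℚ.*<* (+<+ ()))
  infinitely-often-above (mkℚ ℤ.-[1+ _ ] _ _) (ℚ.*<* ())

proposition4p9 : IStable J½ × UpperDensityEq J½ ((+ 1) / 2)
proposition4p9 = J½-IStable , J½-upper-density
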